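{- Let $m_0, n_0$ be odd positive integers with $m_0 \ge 3$, and let $\ell_0$ be an even integer with $0 \le \ell_0 < 4n_0$ such that $m_0n_0 + \ell_0 - 1$ is divisible by $4$ and $n_0$ divides $\ell_0^2 + 3$. Then the graph $\mathcal{X}_a(2m_0, 8m_0n_0, 2m_0n_0+1, 2m_0\ell_0)$ admits an automorphism fixing the vertex $u_{0,0}$ and cyclically permuting its three neighbours.
   Context: For $m$ even, $n$ even, $\ell\in\mathbb{Z}_n$ even and $k\in\mathbb{Z}_n$ odd, $\mathcal{X}_a(m,n,k,\ell)$ is the graph with vertices $u_{i,j}$ ($i\in\mathbb{Z}_m$, $j\in\mathbb{Z}_n$) and edges: $u_{i,j}u_{i,j+1}$ for even $i$ and $u_{i,j}u_{i,j+k}$ for odd $i$ (all $j$); $u_{i,j}u_{i+1,j}$ for integers $0\le i\le m-2$ and $j\equiv i\pmod 2$; $u_{m-1,j}u_{0,j+\ell}$ for odd $j$. -}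

module Defs where

open import Data.Nat using (ℕ; zero; suc; _+_; _*_; _∸_; _<_)
open import Data.Nat.DivMod using (_%_)
open import Data.Nat.Divisibility using (_∣_)
open import Data.Fin using (Fin; toℕ)
open import Data.Product using (_×_; _,_; ∃; ∃-syntax)
open import Data.Sum using (_⊎_)
open import Relation.Nullary using (¬_)
open import Relation.Binary.PropositionalEquality using (_≡_; _≢_)
open import Function.Bundles using (_↔_; Inverse; _⇔_)

-- Vertices u_{i,j} of X_a(m,n,k,ℓ): i ∈ Z_m, j ∈ Z_n (represented by Fin).
Vertex : ℕ → ℕ → Set
Vertex m n = Fin m × Fin n

-- a ≡ b (mod n) for natural numbers, with b the reduced residue:
-- "b is the residue of a modulo n" (a = b + q n for some q).
Res : ℕ → ℕ → ℕ → Set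
Res a b n = ∃[ q ] a ≡ b + q * n

Even Odd : ℕ → Set
Even x = 2 ∣ x
Odd x = ¬ (2 ∣ x)

-- The (directed presentation of the) edges of X_a(m,n,k,ℓ); k and ℓ are
-- natural-number representatives of elements of Z_n.
data Edge (m n k ℓ : ℕ) : Vertex m n → Vertex m n → Set where
  hor-even : ∀ {i j j′} → Even (toℕ i) → Res (toℕ j + 1) (toℕ j′) n →
             Edge m n k ℓ (i , j) (i , j′)
  hor-odd  : ∀ {i j j′} → Odd (toℕ i) → Res (toℕ j + k) (toℕ j′) n →
             Edge m n k ℓ (i , j) (i , j′)
  vert     : ∀ {i i′ j} → toℕ i′ ≡ toℕ i + 1 → toℕ j % 2 ≡ toℕ i % 2 →
             Edge m n k ℓ (i , j) (i′ , j)
  wrap     : ∀ {i i′ j j′} → toℕ i ≡ m ∸ 1 → toℕ i′ ≡ 0 → Odd (toℕ j) →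
             Res (toℕ j + ℓ) (toℕ j′) n →
             Edge m n k ℓ (i , j) (i′ , j′)

Adj : (m n k ℓ : ℕ) → Vertex m n → Vertex m n → Set
Adj m n k ℓ u v = Edge m n k ℓ u v ⊎ Edge m n k ℓ v u

record Automorphism (m n k ℓ : ℕ) : Set where
  field
    perm     : Vertex m n ↔ Vertex m n
    preserve : ∀ u v → Adj m n k ℓ u v ⇔ Adj m n k ℓ (Inverse.to perm u) (Inverse.to perm v)

FixesAndCyclesNeighbours : ∀ {m n k ℓ} → Automorphism m n k ℓ → Vertex m n → Set
FixesAndCyclesNeighbours {m} {n} {k} {ℓ} σ u =
  Inverse.to (Automorphism.perm σ) u ≡ u ×
  ∃[ x ] ∃[ y ] ∃[ z ]
    (Adj m n k ℓ u x × Adj m n k ℓ u y × Adj m n k ℓ u z ×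
     x ≢ y × y ≢ z × x ≢ z ×
     (∀ w → Adj m n k ℓ u w → w ≡ x ⊎ w ≡ y ⊎ w ≡ z) ×
     f x ≡ y × f y ≡ z × f z ≡ x)
  where f = Inverse.to (Automorphism.perm σ)

IsU₀₀ : ∀ {m n} → Vertex m n → Set
IsU₀₀ (i , j) = toℕ i ≡ 0 × toℕ j ≡ 0

-- The vertex u_{i,j} of X_a(m, n, k, ℓ) unfolds to the point (i , j) of ℤ², and X_a is ℤ² modulo the lattice
-- spanned by (m , - ℓ) and (0 , n).  Every point has a red and a green horizontal neighbour and a blue vertical
-- one, at offsets that only depend on the parities of its coordinates, and each colour class is a perfect
-- matching.  Here m = 2 m₀, n = 8 m₀ n₀, k = 2 m₀ n₀ + 1 = 4w + 3 and ℓ = 4 m₀ l, where m₀ n₀ = 2w + 1 and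
-- ℓ₀ = 2l.  Write a point as (ε + 2a , δ + 4b) with class (ε , δ) ∈ Fin 2 × Fin 4.  The map S permuting the
-- eight classes and acting on (a , b) by the unimodular matrix ψ = [[-(w+1), -1], [-w(w+2), -(w+1)]] plus a
-- translation depending on the class fixes the origin and sends red, green and blue edges to green, blue and
-- red edges, up to the lattice Λ = ⟨(m₀ , - m₀ l) , (0 , 2 m₀ n₀)⟩ that the period lattice becomes in
-- (a , b)-coordinates; here 4 ∣ m₀ n₀ + ℓ₀ - 1, i.e. w + l even, is used.  S descends to the required
-- automorphism because ψ preserves Λ, which amounts to 2 n₀ ∣ l² - w (w + 2); this follows from n₀ ∣ ℓ₀² + 3,
-- since 4 (l² - w (w + 2)) = (ℓ₀² + 3) - m₀ n₀ (m₀ n₀ + 2), n₀ is odd and l² - w (w + 2) is even.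
module Submission where

open import Defs

module Rotation where
  open import Data.Empty using (⊥-elim)
  open import Data.Fin using (Fin; zero; suc; toℕ; fromℕ<)
  open import Data.Fin.Properties using (toℕ-injective; toℕ<n; toℕ-fromℕ<)
  open import Data.Integer as ℤ using (ℤ; +_; -[1+_]; +[1+_]; _+_; _*_; -_; _-_; 0ℤ; 1ℤ; -1ℤ)
  open import Data.Integer.DivMod using (_/ℕ_; n%ℕd<d; a≡a%ℕn+[a/ℕn]*n)
  open import Data.Integer.Divisibility.Signed using (divides) renaming (_∣_ to _∣ℤ_)
  open import Data.Integer.Properties using (+-injective; pos-+; pos-*; +-identityʳ; i-j≡0⇒i≡j; *-cancelˡ-≡)
  import Data.Integer.Properties as ℤ
  open import Data.Integer.Tactic.RingSolver using (ring; solve; solve-∀)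
  import Tactic.RingSolver.NonReflective ring as RingSolver
  open RingSolver using (Expr; Κ; Ι) renaming (_⊕_ to _⊕̂_; _⊗_ to _⊗̂_; ⊝_ to ⊝̂_)
  open RingSolver.Ops using (correct; ⟦_⇓⟧) renaming (⟦_⟧ to eval)
  open import Data.List using ([]; _∷_)
  import Data.Vec as Vec
  open import Data.Nat as ℕ using (ℕ; zero; suc; NonZero; _<_; _≤_; _^_; _∸_; z≤n; s≤s)
  open import Data.Nat.DivMod using (_%_; _/_; _mod_; m%n<n; m≡m%n+[m/n]*n; %-pred-≡0; %-remove-+ʳ; m∣n⇒o%n%m≡o%m)
  open import Data.Nat.Divisibility using (divides; n∣m⇒m%n≡0; m%n≡0⇒n∣m; ∣m⇒∣m*n; ∣n⇒∣m*n)
  import Data.Nat.Properties as ℕ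
  open import Data.Product using (_×_; _,_; proj₁; proj₂; ∃-syntax)
  open import Data.Product.Relation.Binary.Pointwise.NonDependent using (Pointwise; ×-isEquivalence)
  open import Data.Sum using (_⊎_; inj₁; inj₂)
  open import Function.Bundles using (_⇔_; mk⇔; mk↔ₛ′; Equivalence)
  open import Function.Definitions using (Congruent)
  open import Relation.Binary.Bundles using (Setoid)
  open import Relation.Binary.PropositionalEquality
    using (_≡_; _≢_; refl; sym; trans; cong; cong₂; subst; subst₂; isEquivalence; module ≡-Reasoning)
  import Relation.Binary.Reasoning.Setoid as SetoidReasoning
  open import Relation.Binary.Structures using (IsEquivalence)
  open import Relation.Nullary using (¬_)

  pos-+* : ∀ a b c → + a + + b * + c ≡ + (a ℕ.+ b ℕ.* c)
  pos-+* a b c = trans (cong (λ t → + a + t) (sym (pos-* b c))) (sym (pos-+ a (b ℕ.* c)))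

  pos-double : ∀ x → + (x ℕ.* 2) ≡ + 2 * + x
  pos-double x = trans (pos-* x 2) (ℤ.*-comm (+ x) (+ 2))

  pos-odd : ∀ x → + suc (x ℕ.* 2) ≡ 1ℤ + + 2 * + x
  pos-odd x = trans (pos-+ 1 (x ℕ.* 2)) (cong (λ t → 1ℤ + t) (pos-double x))

  move-multiple : ∀ {x y} (q M : ℤ) → x ≡ y + q * M → y ≡ x + (- q) * M
  move-multiple {y = y} q M refl = solve (y ∷ q ∷ M ∷ [])

  move-summand : ∀ {a} b h c → a + h ≡ b + c → a ≡ b + - h + c
  move-summand {a} b h c eq = begin
    a              ≡⟨ solve (a ∷ h ∷ []) ⟩
    a + h + - h    ≡⟨ cong (_+ - h) eq ⟩
    b + c + - h    ≡⟨ solve (b ∷ c ∷ h ∷ []) ⟩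
    b + - h + c    ∎
    where open ≡-Reasoning

  move-summand⁻ : ∀ {a} b h c → a ≡ b + - h + c → a + h ≡ b + c
  move-summand⁻ b h c refl = solve (b ∷ h ∷ c ∷ [])

  i≡j+1⇒j≡i-1 : ∀ {x y} → x ≡ y + 1ℤ → y ≡ x + -1ℤ
  i≡j+1⇒j≡i-1 {y = y} refl = solve (y ∷ [])

  positive-multiple : ∀ {M x y r} → + x ≡ + y + +[1+ r ] * + M → M ≤ x
  positive-multiple {M} {x} {y} {r} eq =
    subst (M ≤_) (sym (+-injective (trans eq (pos-+* y (suc r) M)))) (ℕ.≤-trans (ℕ.m≤m+n M (r ℕ.* M)) (ℕ.m≤n+m _ y))

  negative-multiple : ∀ {M x y r} → + x ≡ + y + -[1+ r ] * + M → M ≤ y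
  negative-multiple {M} {x} {y} {r} eq = positive-multiple {M} {y} {x} {r} (move-multiple -[1+ r ] (+ M) eq)

  residue-unique : ∀ {M x y} (q : ℤ) → x < M → y < M → + x ≡ + y + q * + M → x ≡ y × q ≡ 0ℤ
  residue-unique {y = y} (+ zero) _ _ eq = +-injective (trans eq (+-identityʳ (+ y))) , refl
  residue-unique +[1+ r ] x<M _ eq = ⊥-elim (ℕ.<⇒≱ x<M (positive-multiple {r = r} eq))
  residue-unique -[1+ r ] _ y<M eq = ⊥-elim (ℕ.<⇒≱ y<M (negative-multiple {r = r} eq))

  residue⇒Res : ∀ {n x y} (q : ℤ) → y < n → + x ≡ + y + q * + n → Res x y n
  residue⇒Res {n} {y = y} (+ r) _ eq = r , +-injective (trans eq (pos-+* y r n))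
  residue⇒Res -[1+ r ] y<n eq = ⊥-elim (ℕ.<⇒≱ y<n (negative-multiple {r = r} eq))

  Res⇒residue : ∀ {n x y} → (r : Res x y n) → + x ≡ + y + + proj₁ r * + n
  Res⇒residue {n} {y = y} (r , eq) = trans (cong +_ eq) (sym (pos-+* y r n))

  isolate-digit : ∀ {e e′ B a a′ : ℤ} → e + B * a ≡ e′ + B * a′ → e ≡ e′ + (a′ - a) * B
  isolate-digit {e} {e′} {B} {a} {a′} eq = begin
    e                       ≡⟨ solve (e ∷ B ∷ a ∷ []) ⟩
    e + B * a - B * a       ≡⟨ cong (_- B * a) eq ⟩
    e′ + B * a′ - B * a     ≡⟨ solve (e′ ∷ B ∷ a′ ∷ a ∷ []) ⟩
    e′ + (a′ - a) * B       ∎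
    where open ≡-Reasoning

  digits-unique : ∀ {B x x′} a a′ → x < B → x′ < B → + x + + B * a ≡ + x′ + + B * a′ → x ≡ x′ × a ≡ a′
  digits-unique {B} {x} {x′} a a′ x<B x′<B eq
    with x≡x′ , a′-a≡0 ← residue-unique (a′ - a) x<B x′<B (isolate-digit {+ x} {+ x′} {+ B} eq) =
    x≡x′ , sym (i-j≡0⇒i≡j a′ a a′-a≡0)

  digit-expansion : ∀ x B .{{_ : NonZero B}} → + toℕ (x mod B) + + B * + (x / B) ≡ + x
  digit-expansion x B = begin
    + toℕ (x mod B) + + B * + (x / B)   ≡⟨ cong₂ (λ r s → + r + s) (toℕ-fromℕ< _) (sym (pos-* B (x / B))) ⟩
    + (x % B) + + (B ℕ.* (x / B))       ≡⟨ pos-+ (x % B) _ ⟨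
    + (x % B ℕ.+ B ℕ.* (x / B))         ≡⟨ cong (λ t → + (x % B ℕ.+ t)) (ℕ.*-comm B (x / B)) ⟩
    + (x % B ℕ.+ x / B ℕ.* B)           ≡⟨ cong +_ (m≡m%n+[m/n]*n x B) ⟨
    + x                                 ∎
    where open ≡-Reasoning

  %2-cases : ∀ x → x % 2 ≡ 0 ⊎ x % 2 ≡ 1
  %2-cases 0 = inj₁ refl
  %2-cases 1 = inj₂ refl
  %2-cases (suc (suc x)) = %2-cases x

  %2-flip : ∀ x → x % 2 ≡ 1 ∸ suc x % 2
  %2-flip 0 = refl
  %2-flip 1 = refl
  %2-flip (suc (suc x)) = %2-flip x

  %2≢2+ : ∀ {x y} → x % 2 ≢ suc (suc y)
  %2≢2+ {x} e = ℕ.<⇒≱ (m%n<n x 2) (subst (2 ≤_) (sym e) (s≤s (s≤s z≤n)))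

  %2≡0⇒even : ∀ {x} → x % 2 ≡ 0 → Even x
  %2≡0⇒even {x} = m%n≡0⇒n∣m x 2

  %2≡1⇒odd : ∀ {x} → x % 2 ≡ 1 → Odd x
  %2≡1⇒odd {x} e even with () ← trans (sym e) (n∣m⇒m%n≡0 x 2 even)

  odd⇒%2≡1 : ∀ {x} → Odd x → x % 2 ≡ 1
  odd⇒%2≡1 {x} odd with %2-cases x
  ... | inj₁ e = ⊥-elim (odd (%2≡0⇒even e))
  ... | inj₂ e = e

  odd⇒suc-double : ∀ {x} → Odd x → x ≡ suc (x / 2 ℕ.* 2)
  odd⇒suc-double {x} odd = trans (m≡m%n+[m/n]*n x 2) (cong (ℕ._+ x / 2 ℕ.* 2) (odd⇒%2≡1 odd))

  -- The lattice congruence on ℤ²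

  infixl 6 _⊕_
  _⊕_ : ℤ × ℤ → ℤ × ℤ → ℤ × ℤ
  (x , y) ⊕ (x′ , y′) = x + x′ , y + y′

  neg : ℤ × ℤ → ℤ × ℤ
  neg (x , y) = - x , - y

  record Matrix (A : Set) : Set where
    constructor matrix
    field α β γ δ : A

  infixr 7 _·_
  _·_ : Matrix ℤ → ℤ × ℤ → ℤ × ℤ
  matrix α β γ δ · (x , y) = α * x + β * y , γ * x + δ * y

  ⊕-assoc : ∀ u v x → u ⊕ v ⊕ x ≡ u ⊕ (v ⊕ x)
  ⊕-assoc (a , b) (c , d) (e , f) = cong₂ _,_ (ℤ.+-assoc a c e) (ℤ.+-assoc b d f)

  ⊕-neg-cancel : ∀ u s → u ⊕ neg s ⊕ s ≡ u
  ⊕-neg-cancel (a , b) (x , y) = cong₂ _,_ (cancel a x) (cancel b y)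
    where
    cancel : ∀ a x → a + - x + x ≡ a
    cancel = solve-∀

  ⊕-cancel-neg : ∀ u s → u ⊕ s ⊕ neg s ≡ u
  ⊕-cancel-neg (a , b) (x , y) = cong₂ _,_ (cancel a x) (cancel b y)
    where
    cancel : ∀ a x → a + x + - x ≡ a
    cancel = solve-∀

  ·-⊕-shift : ∀ A v t s → A · (v ⊕ t) ⊕ s ≡ A · v ⊕ (A · t ⊕ s)
  ·-⊕-shift (matrix α β γ δ) (a , b) (x , y) (e , f) = cong₂ _,_ (shift α β a b x y e) (shift γ δ a b x y f)
    where
    shift : ∀ α β a b x y e → α * (a + x) + β * (b + y) + e ≡ α * a + β * b + (α * x + β * y + e)
    shift = solve-∀

  module Lattice (M N L : ℤ) where

    open ≡-Reasoning

    infix 4 _≋_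
    record _≋_ (x y : ℤ × ℤ) : Set where
      constructor ≋-by
      field
        q p    : ℤ
        fst-eq : proj₁ x ≡ proj₁ y + q * M
        snd-eq : proj₂ x ≡ proj₂ y + p * N - q * L

    -- The ring solver does not reduce projections, so lattice relations are built from explicit pairs.
    ≋-at : ∀ {x y x′ y′} q p → x ≡ x′ + q * M → y ≡ y′ + p * N - q * L → (x , y) ≋ (x′ , y′)
    ≋-at = ≋-by

    ≋-isEquivalence : IsEquivalence _≋_
    ≋-isEquivalence = record { refl = ≋-refl ; sym = ≋-sym ; trans = ≋-trans }
      where
      ≋-refl : ∀ {x} → x ≋ x
      ≋-refl {x , y} = ≋-at 0ℤ 0ℤ (solve (x ∷ M ∷ [])) (solve (y ∷ N ∷ L ∷ []))
      ≋-sym : ∀ {x y} → x ≋ y → y ≋ x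
      ≋-sym {_ , _} {x , y} (≋-by q p refl refl) =
        ≋-at (- q) (- p) (solve (x ∷ q ∷ M ∷ [])) (solve (y ∷ p ∷ q ∷ N ∷ L ∷ []))
      ≋-trans : ∀ {x y z} → x ≋ y → y ≋ z → x ≋ z
      ≋-trans {_ , _} {_ , _} {x , y} (≋-by q p refl refl) (≋-by q′ p′ refl refl) =
        ≋-at (q′ + q) (p′ + p) (solve (x ∷ q ∷ q′ ∷ M ∷ [])) (solve (y ∷ p ∷ q ∷ p′ ∷ q′ ∷ N ∷ L ∷ []))

    ≋-setoid : Setoid _ _
    ≋-setoid = record { isEquivalence = ≋-isEquivalence }

    ⊕-cong : ∀ {v v′} d → v ≋ v′ → v ⊕ d ≋ v′ ⊕ d
    ⊕-cong {_ , _} {a , b} (x , y) (≋-by q p refl refl) =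
      ≋-at q p (solve (a ∷ x ∷ q ∷ M ∷ [])) (solve (b ∷ y ∷ p ∷ q ∷ N ∷ L ∷ []))

    ⊕-congˡ : ∀ u {d d′} → d ≋ d′ → u ⊕ d ≋ u ⊕ d′
    ⊕-congˡ (x , y) {_ , _} {a , b} (≋-by q p refl refl) =
      ≋-at q p (solve (x ∷ a ∷ q ∷ M ∷ [])) (solve (y ∷ b ∷ p ∷ q ∷ N ∷ L ∷ []))

    ⊕-absorb : ∀ u {d} → d ≋ (0ℤ , 0ℤ) → u ⊕ d ≋ u
    ⊕-absorb (x , y) {_ , _} (≋-by q p refl refl) =
      ≋-at q p (solve (x ∷ q ∷ M ∷ [])) (solve (y ∷ p ∷ q ∷ N ∷ L ∷ []))

    neg-≋ : ∀ {d} → d ≋ (0ℤ , 0ℤ) → neg d ≋ (0ℤ , 0ℤ)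
    neg-≋ {_ , _} (≋-by q p refl refl) = ≋-at (- q) (- p) (solve (q ∷ M ∷ [])) (solve (p ∷ q ∷ N ∷ L ∷ []))

    ·-cong : ∀ (A : Matrix ℤ) → A · (M , - L) ≋ (0ℤ , 0ℤ) → A · (0ℤ , N) ≋ (0ℤ , 0ℤ) →
             ∀ {v v′} → v ≋ v′ → A · v ≋ A · v′
    ·-cong (matrix α β γ δ) (≋-by q₁ p₁ e₁ f₁) (≋-by q₂ p₂ e₂ f₂) {_ , _} {a , b} (≋-by q p refl refl) =
      ≋-by (q * q₁ + p * q₂) (q * p₁ + p * p₂) fst snd
      where
      fst : α * (a + q * M) + β * (b + p * N - q * L) ≡ α * a + β * b + (q * q₁ + p * q₂) * M
      fst = begin
        α * (a + q * M) + β * (b + p * N - q * L)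
          ≡⟨ solve (α ∷ β ∷ a ∷ b ∷ q ∷ p ∷ M ∷ N ∷ L ∷ []) ⟩
        α * a + β * b + q * (α * M + β * - L) + p * (α * 0ℤ + β * N)
          ≡⟨ cong₂ (λ s t → α * a + β * b + q * s + p * t) e₁ e₂ ⟩
        α * a + β * b + q * (0ℤ + q₁ * M) + p * (0ℤ + q₂ * M)
          ≡⟨ solve (α ∷ β ∷ a ∷ b ∷ q ∷ p ∷ q₁ ∷ q₂ ∷ M ∷ []) ⟩
        α * a + β * b + (q * q₁ + p * q₂) * M
          ∎
      snd : γ * (a + q * M) + δ * (b + p * N - q * L) ≡ γ * a + δ * b + (q * p₁ + p * p₂) * N - (q * q₁ + p * q₂) * L
      snd = begin
        γ * (a + q * M) + δ * (b + p * N - q * L)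
          ≡⟨ solve (γ ∷ δ ∷ a ∷ b ∷ q ∷ p ∷ M ∷ N ∷ L ∷ []) ⟩
        γ * a + δ * b + q * (γ * M + δ * - L) + p * (γ * 0ℤ + δ * N)
          ≡⟨ cong₂ (λ s t → γ * a + δ * b + q * s + p * t) f₁ f₂ ⟩
        γ * a + δ * b + q * (0ℤ + p₁ * N - q₁ * L) + p * (0ℤ + p₂ * N - q₂ * L)
          ≡⟨ solve (γ ∷ δ ∷ a ∷ b ∷ q ∷ p ∷ q₁ ∷ q₂ ∷ p₁ ∷ p₂ ∷ N ∷ L ∷ []) ⟩
        γ * a + δ * b + (q * p₁ + p * p₂) * N - (q * q₁ + p * q₂) * L
          ∎

    ≋-from-division : ∀ {x y r s} (Q P : ℤ) → x ≡ r + Q * M → y + Q * L ≡ s + P * N → (r , s) ≋ (x , y)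
    ≋-from-division {x} {y} {r} {s} Q P refl eq = ≋-at (- Q) (- P) (solve (r ∷ Q ∷ M ∷ [])) (begin
      s                               ≡⟨ solve (s ∷ P ∷ N ∷ []) ⟩
      s + P * N + (- P) * N           ≡⟨ cong (_+ (- P) * N) eq ⟨
      y + Q * L + (- P) * N           ≡⟨ solve (y ∷ Q ∷ L ∷ P ∷ N ∷ []) ⟩
      y + (- P) * N - (- Q) * L       ∎)

    along-column : ∀ x y {y′} d p → y′ ≡ y + d + p * N → (x , y′) ≋ (x + 0ℤ , y + d)
    along-column x y d p refl = ≋-at 0ℤ p (solve (x ∷ M ∷ [])) (solve (y ∷ d ∷ p ∷ N ∷ L ∷ []))

    along-row : ∀ x y {x′} d → x′ ≡ x + d → (x′ , y) ≋ (x + d , y + 0ℤ)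
    along-row x y d refl = ≋-at 0ℤ 0ℤ (solve (x ∷ d ∷ M ∷ [])) (solve (y ∷ N ∷ L ∷ []))

    across-top : ∀ x y {y′} p → x + 1ℤ ≡ M → y′ ≡ y + L + p * N → (0ℤ , y′) ≋ (x + 1ℤ , y + 0ℤ)
    across-top x y p top refl =
      ≋-at -1ℤ p (sym (trans (cong (_+ -1ℤ * M) top) (solve (M ∷ [])))) (solve (y ∷ L ∷ p ∷ N ∷ []))

    across-bottom : ∀ x′ y {y′} p → x′ + 1ℤ ≡ M → y′ + L ≡ y + p * N → (x′ , y′) ≋ (0ℤ + -1ℤ , y + 0ℤ)
    across-bottom x′ y {y′} p top eq = ≋-at 1ℤ p fst snd
      where
      fst : x′ ≡ 0ℤ + -1ℤ + 1ℤ * M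
      fst = begin
        x′                           ≡⟨ solve (x′ ∷ []) ⟩
        0ℤ + -1ℤ + 1ℤ * (x′ + 1ℤ)    ≡⟨ cong (λ t → 0ℤ + -1ℤ + 1ℤ * t) top ⟩
        0ℤ + -1ℤ + 1ℤ * M            ∎
      snd : y′ ≡ y + 0ℤ + p * N - 1ℤ * L
      snd = begin
        y′                        ≡⟨ solve (y′ ∷ L ∷ []) ⟩
        y′ + L - L                ≡⟨ cong (_- L) eq ⟩
        y + p * N - L             ≡⟨ solve (y ∷ p ∷ N ∷ L ∷ []) ⟩
        y + 0ℤ + p * N - 1ℤ * L   ∎

    above-top : ∀ {x} a q → a + 1ℤ ≡ M → x ≡ a + 1ℤ + q * M → x ≡ 0ℤ + (q + 1ℤ) * M
    above-top {x} a q top eq = begin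
      x                       ≡⟨ eq ⟩
      a + 1ℤ + q * M          ≡⟨ cong (_+ q * M) top ⟩
      M + q * M               ≡⟨ solve (q ∷ M ∷ []) ⟩
      0ℤ + (q + 1ℤ) * M       ∎

    below-bottom : ∀ {x} a q → a + 1ℤ ≡ M → x ≡ 0ℤ + -1ℤ + q * M → x ≡ a + (q - 1ℤ) * M
    below-bottom {x} a q top eq = begin
      x                             ≡⟨ eq ⟩
      0ℤ + -1ℤ + q * M              ≡⟨ cong (λ t → 0ℤ + -1ℤ + q * t) top ⟨
      0ℤ + -1ℤ + q * (a + 1ℤ)       ≡⟨ solve (a ∷ q ∷ []) ⟩
      a + (q - 1ℤ) * (a + 1ℤ)       ≡⟨ cong (λ t → a + (q - 1ℤ) * t) top ⟩
      a + (q - 1ℤ) * M              ∎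

    crossing-up : ∀ {y′} y p → y′ ≡ y + 0ℤ + p * N - -1ℤ * L → y + L ≡ y′ + (- p) * N
    crossing-up y p refl = solve (y ∷ p ∷ N ∷ L ∷ [])

    crossing-down : ∀ {y′} y p → y′ ≡ y + 0ℤ + p * N - 1ℤ * L → y′ + L ≡ y + p * N
    crossing-down y p refl = solve (y ∷ p ∷ N ∷ L ∷ [])

  -- X_a(m, n, k, ℓ) as a quotient of ℤ²

  data Colour : Set where
    red green blue : Colour

  rotate rotate⁻¹ : Colour → Colour
  rotate red   = green
  rotate green = blue
  rotate blue  = red
  rotate⁻¹ red   = blue
  rotate⁻¹ green = red
  rotate⁻¹ blue  = green

  rotate-rotate⁻¹ : ∀ col → rotate (rotate⁻¹ col) ≡ col
  rotate-rotate⁻¹ red   = refl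
  rotate-rotate⁻¹ green = refl
  rotate-rotate⁻¹ blue  = refl

  -- Red and green lead to the two horizontal neighbours (at distance 1 in even rows and K in odd rows),
  -- blue to the vertical one; the signs alternate with the parity of I + J, so that each colour class is
  -- a perfect matching.
  offset : ℤ → Colour → ℕ → ℕ → ℤ × ℤ
  offset K red   zero    zero    = 0ℤ , 1ℤ
  offset K red   zero    (suc _) = 0ℤ , -1ℤ
  offset K red   (suc _) zero    = 0ℤ , - K
  offset K red   (suc _) (suc _) = 0ℤ , K
  offset K green zero    zero    = 0ℤ , -1ℤ
  offset K green zero    (suc _) = 0ℤ , 1ℤ
  offset K green (suc _) zero    = 0ℤ , K
  offset K green (suc _) (suc _) = 0ℤ , - K
  offset K blue  zero    zero    = 1ℤ , 0ℤ
  offset K blue  zero    (suc _) = -1ℤ , 0ℤ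
  offset K blue  (suc _) zero    = -1ℤ , 0ℤ
  offset K blue  (suc _) (suc _) = 1ℤ , 0ℤ

  module Plane (m n k ℓ : ℕ) .{{_ : NonZero m}} .{{_ : NonZero n}}
               (m-even : Even m) (n-even : Even n) (ℓ-even : Even ℓ) where

    open Lattice (+ m) (+ n) (+ ℓ) public

    coord : Vertex m n → ℤ × ℤ
    coord (i , j) = + toℕ i , + toℕ j

    reduce : ℤ × ℤ → Vertex m n
    reduce (x , y) = fromℕ< (n%ℕd<d x m) , fromℕ< (n%ℕd<d (y + (x /ℕ m) * + ℓ) n)

    coord-reduce : ∀ z → coord (reduce z) ≋ z
    coord-reduce (x , y) =
      ≋-from-division (x /ℕ m) (y′ /ℕ n)
        (trans (a≡a%ℕn+[a/ℕn]*n x m) (cong (λ r → + r + (x /ℕ m) * + m) (sym (toℕ-fromℕ< _))))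
        (trans (a≡a%ℕn+[a/ℕn]*n y′ n) (cong (λ r → + r + (y′ /ℕ n) * + n) (sym (toℕ-fromℕ< _))))
      where y′ = y + (x /ℕ m) * + ℓ

    private
      drop-row-shift : ∀ {x} y p → x ≡ y + p * + n - 0ℤ * + ℓ → x ≡ y + p * + n
      drop-row-shift y p eq = trans eq (+-identityʳ (y + p * + n))

    coord-injective : ∀ {u v} → coord u ≋ coord v → u ≡ v
    coord-injective {i , j} {i′ , j′} (≋-by q p eq₁ eq₂) with residue-unique q (toℕ<n i) (toℕ<n i′) eq₁
    ... | i≡i′ , refl = cong₂ _,_ (toℕ-injective i≡i′)
                          (toℕ-injective (proj₁ (residue-unique p (toℕ<n j) (toℕ<n j′) (drop-row-shift (+ toℕ j′) p eq₂))))

    Neighbour : Colour → Vertex m n → Vertex m n → Set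
    Neighbour col (i , j) v = coord v ≋ coord (i , j) ⊕ offset (+ k) col (toℕ i % 2) (toℕ j % 2)

    private
      last-row : + (m ∸ 1) + 1ℤ ≡ + m
      last-row = trans (sym (pos-+ (m ∸ 1) 1)) (cong +_ (trans (ℕ.+-comm (m ∸ 1) 1) (ℕ.suc-pred m)))

      last-row-odd : (m ∸ 1) % 2 ≡ 1
      last-row-odd = %-pred-≡0 {m ∸ 1} (trans (cong (_% 2) (ℕ.suc-pred m)) (n∣m⇒m%n≡0 m 2 m-even))

      below-parity : ∀ {x y} → x ≡ y ℕ.+ 1 → y % 2 ≡ 1 ∸ x % 2
      below-parity {y = y} refl = trans (%2-flip y) (cong (λ t → 1 ∸ t % 2) (ℕ.+-comm 1 y))

      Res-parity : ∀ {x y} → Res (x ℕ.+ ℓ) y n → x % 2 ≡ y % 2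
      Res-parity {x} {y} (r , eq) = begin
        x % 2                ≡⟨ %-remove-+ʳ x ℓ-even ⟨
        (x ℕ.+ ℓ) % 2        ≡⟨ cong (_% 2) eq ⟩
        (y ℕ.+ r ℕ.* n) % 2  ≡⟨ %-remove-+ʳ y (∣n⇒∣m*n r n-even) ⟩
        y % 2                ∎
        where open ≡-Reasoning

      right-edge : ∀ x {J J′} h → Res (J ℕ.+ h) J′ n → (x , + J′) ≋ (x + 0ℤ , + J + + h)
      right-edge x {J} h r@(q , _) =
        along-column x (+ J) (+ h) (- + q) (trans (move-multiple (+ q) (+ n) (Res⇒residue r)) (cong (_+ - + q * + n) (pos-+ J h)))

      left-edge : ∀ x {J J′} h → Res (J′ ℕ.+ h) J n → (x , + J′) ≋ (x + 0ℤ , + J + - + h)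
      left-edge x {J} {J′} h r@(q , _) =
        along-column x (+ J) (- + h) (+ q) (move-summand (+ J) (+ h) (+ q * + n) (trans (sym (pos-+ J′ h)) (Res⇒residue r)))

      up-edge : ∀ {I I′} y → I′ ≡ I ℕ.+ 1 → (+ I′ , y) ≋ (+ I + 1ℤ , y + 0ℤ)
      up-edge {I} y e = along-row (+ I) y 1ℤ (trans (cong +_ e) (pos-+ I 1))

      down-edge : ∀ {I I′} y → I ≡ I′ ℕ.+ 1 → (+ I′ , y) ≋ (+ I + -1ℤ , y + 0ℤ)
      down-edge {I} {I′} y e = along-row (+ I) y -1ℤ (i≡j+1⇒j≡i-1 (trans (cong +_ e) (pos-+ I′ 1)))

      top-edge : ∀ {J J′} → Res (J ℕ.+ ℓ) J′ n → (0ℤ , + J′) ≋ (+ (m ∸ 1) + 1ℤ , + J + 0ℤ)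
      top-edge {J} r@(q , _) =
        across-top (+ (m ∸ 1)) (+ J) (- + q) last-row
          (trans (move-multiple (+ q) (+ n) (Res⇒residue r)) (cong (_+ - + q * + n) (pos-+ J ℓ)))

      bottom-edge : ∀ {J J′} → Res (J′ ℕ.+ ℓ) J n → (+ (m ∸ 1) , + J′) ≋ (0ℤ + -1ℤ , + J + 0ℤ)
      bottom-edge {J} {J′} r@(q , _) = across-bottom (+ (m ∸ 1)) (+ J) (+ q) last-row (trans (sym (pos-+ J′ ℓ)) (Res⇒residue r))

      edge⇒neighbour : ∀ {u v} → Edge m n k ℓ u v → ∃[ col ] Neighbour col u v
      edge⇒neighbour {i , j} (hor-even ev r) with %2-cases (toℕ j)
      ... | inj₁ δ rewrite n∣m⇒m%n≡0 _ 2 ev | δ = red , right-edge _ 1 r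
      ... | inj₂ δ rewrite n∣m⇒m%n≡0 _ 2 ev | δ = green , right-edge _ 1 r
      edge⇒neighbour {i , j} (hor-odd od r) with %2-cases (toℕ j)
      ... | inj₁ δ rewrite odd⇒%2≡1 od | δ = green , right-edge _ k r
      ... | inj₂ δ rewrite odd⇒%2≡1 od | δ = red , right-edge _ k r
      edge⇒neighbour {i , j} (vert e pr) rewrite pr with %2-cases (toℕ i)
      ... | inj₁ ε rewrite ε = blue , up-edge _ e
      ... | inj₂ ε rewrite ε = blue , up-edge _ e
      edge⇒neighbour (wrap ei ei′ oj r) rewrite ei | ei′ | last-row-odd | odd⇒%2≡1 oj = blue , top-edge r

      edge⇒neighbour⁻ : ∀ {u v} → Edge m n k ℓ v u → ∃[ col ] Neighbour col u v
      edge⇒neighbour⁻ {i , j} (hor-even ev r) with %2-cases (toℕ j)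
      ... | inj₁ δ rewrite n∣m⇒m%n≡0 _ 2 ev | δ = green , left-edge _ 1 r
      ... | inj₂ δ rewrite n∣m⇒m%n≡0 _ 2 ev | δ = red , left-edge _ 1 r
      edge⇒neighbour⁻ {i , j} (hor-odd od r) with %2-cases (toℕ j)
      ... | inj₁ δ rewrite odd⇒%2≡1 od | δ = red , left-edge _ k r
      ... | inj₂ δ rewrite odd⇒%2≡1 od | δ = green , left-edge _ k r
      edge⇒neighbour⁻ {i , j} (vert e pr) with %2-cases (toℕ i)
      ... | inj₁ ε rewrite ε | trans pr (trans (below-parity e) (cong (1 ∸_) ε)) = blue , down-edge _ e
      ... | inj₂ ε rewrite ε | trans pr (trans (below-parity e) (cong (1 ∸_) ε)) = blue , down-edge _ e
      edge⇒neighbour⁻ (wrap ei′ ei oj′ r) rewrite ei | ei′ | sym (Res-parity r) | odd⇒%2≡1 oj′ = blue , bottom-edge r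

      reaches-top : ∀ {I} → suc I ≡ m → + I + 1ℤ ≡ + m
      reaches-top {I} at-top = trans (sym (pos-+ I 1)) (cong +_ (trans (ℕ.+-comm I 1) at-top))

      same-column : ∀ {j j′ : Fin n} p → + toℕ j′ ≡ + toℕ j + 0ℤ + p * + n - 0ℤ * + ℓ → j′ ≡ j
      same-column {j} {j′} p eq = toℕ-injective (proj₁ (residue-unique p (toℕ<n j′) (toℕ<n j)
                                    (trans (drop-row-shift (+ toℕ j + 0ℤ) p eq) (cong (_+ p * + n) (+-identityʳ (+ toℕ j))))))

      right-of : ∀ {i i′ : Fin m} {j j′ : Fin n} h → coord (i′ , j′) ≋ (+ toℕ i + 0ℤ , + toℕ j + + h) →
                 i′ ≡ i × Res (toℕ j ℕ.+ h) (toℕ j′) n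
      right-of {i} {i′} {j} {j′} h (≋-by q p eq₁ eq₂)
        with e , refl ← residue-unique q (toℕ<n i′) (toℕ<n i) (trans eq₁ (cong (_+ q * + m) (+-identityʳ (+ toℕ i)))) =
        toℕ-injective e ,
        residue⇒Res (- p) (toℕ<n j′) (trans (pos-+ (toℕ j) h) (move-multiple p (+ n) (drop-row-shift (+ toℕ j + + h) p eq₂)))

      left-of : ∀ {i i′ : Fin m} {j j′ : Fin n} h → coord (i′ , j′) ≋ (+ toℕ i + 0ℤ , + toℕ j + - + h) →
                i′ ≡ i × Res (toℕ j′ ℕ.+ h) (toℕ j) n
      left-of {i} {i′} {j} {j′} h (≋-by q p eq₁ eq₂)
        with e , refl ← residue-unique q (toℕ<n i′) (toℕ<n i) (trans eq₁ (cong (_+ q * + m) (+-identityʳ (+ toℕ i)))) =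
        toℕ-injective e ,
        residue⇒Res p (toℕ<n j)
          (trans (pos-+ (toℕ j′) h) (move-summand⁻ (+ toℕ j) (+ h) (p * + n) (drop-row-shift (+ toℕ j + - + h) p eq₂)))

      above : ∀ {i i′ : Fin m} {j j′ : Fin n} → coord (i′ , j′) ≋ (+ toℕ i + 1ℤ , + toℕ j + 0ℤ) →
              (toℕ i′ ≡ toℕ i ℕ.+ 1 × j′ ≡ j) ⊎
              (toℕ i ≡ m ∸ 1 × toℕ i′ ≡ 0 × Res (toℕ j ℕ.+ ℓ) (toℕ j′) n)
      above {i} {i′} {j} {j′} (≋-by q p eq₁ eq₂) with ℕ.m≤n⇒m<n∨m≡n (toℕ<n i)
      ... | inj₁ below-top
        with e , refl ← residue-unique q (toℕ<n i′) (subst (_< m) (ℕ.+-comm 1 (toℕ i)) below-top)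
                                           (trans eq₁ (cong (_+ q * + m) (sym (pos-+ (toℕ i) 1)))) =
        inj₁ (e , same-column p eq₂)
      ... | inj₂ at-top
        with e , q+1≡0 ← residue-unique (q + 1ℤ) (toℕ<n i′) (ℕ.>-nonZero⁻¹ m)
                                         (above-top (+ toℕ i) q (reaches-top at-top) eq₁)
        with refl ← i-j≡0⇒i≡j q -1ℤ q+1≡0 =
        inj₂ (cong ℕ.pred at-top , e ,
              residue⇒Res (- p) (toℕ<n j′) (trans (pos-+ (toℕ j) ℓ) (crossing-up (+ toℕ j) p eq₂)))

      below : ∀ {i i′ : Fin m} {j j′ : Fin n} → coord (i′ , j′) ≋ (+ toℕ i + -1ℤ , + toℕ j + 0ℤ) →
              (toℕ i ≡ toℕ i′ ℕ.+ 1 × j′ ≡ j) ⊎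
              (toℕ i′ ≡ m ∸ 1 × toℕ i ≡ 0 × Res (toℕ j′ ℕ.+ ℓ) (toℕ j) n)
      below {i} {i′} {j} {j′} (≋-by q p eq₁ eq₂) with toℕ i in ei
      ... | suc I
        with e , refl ← residue-unique q (toℕ<n i′) (ℕ.<⇒≤ (subst (_< m) ei (toℕ<n i))) eq₁ =
        inj₁ (trans (ℕ.+-comm 1 I) (cong (ℕ._+ 1) (sym e)) , same-column p eq₂)
      ... | zero
        with e , q-1≡0 ← residue-unique (q - 1ℤ) (toℕ<n i′) (ℕ.≤-reflexive (ℕ.suc-pred m))
                                         (below-bottom (+ (m ∸ 1)) q last-row eq₁)
        with refl ← i-j≡0⇒i≡j q 1ℤ q-1≡0 =
        inj₂ (e , refl , residue⇒Res p (toℕ<n j) (trans (pos-+ (toℕ j′) ℓ) (crossing-down (+ toℕ j) p eq₂)))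

      offset⇒adjacent : ∀ col {i i′ : Fin m} {j j′ : Fin n} {ε δ} → toℕ i % 2 ≡ ε → toℕ j % 2 ≡ δ →
                        coord (i′ , j′) ≋ coord (i , j) ⊕ offset (+ k) col ε δ → Adj m n k ℓ (i , j) (i′ , j′)
      offset⇒adjacent red   {ε = 0} {0} e _ nb with refl , r ← right-of 1 nb = inj₁ (hor-even (%2≡0⇒even e) r)
      offset⇒adjacent red   {ε = 0} {1} e _ nb with refl , r ← left-of 1 nb  = inj₂ (hor-even (%2≡0⇒even e) r)
      offset⇒adjacent red   {ε = 1} {0} e _ nb with refl , r ← left-of k nb  = inj₂ (hor-odd (%2≡1⇒odd e) r)
      offset⇒adjacent red   {ε = 1} {1} e _ nb with refl , r ← right-of k nb = inj₁ (hor-odd (%2≡1⇒odd e) r)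
      offset⇒adjacent green {ε = 0} {0} e _ nb with refl , r ← left-of 1 nb  = inj₂ (hor-even (%2≡0⇒even e) r)
      offset⇒adjacent green {ε = 0} {1} e _ nb with refl , r ← right-of 1 nb = inj₁ (hor-even (%2≡0⇒even e) r)
      offset⇒adjacent green {ε = 1} {0} e _ nb with refl , r ← right-of k nb = inj₁ (hor-odd (%2≡1⇒odd e) r)
      offset⇒adjacent green {ε = 1} {1} e _ nb with refl , r ← left-of k nb  = inj₂ (hor-odd (%2≡1⇒odd e) r)
      offset⇒adjacent blue  {ε = 0} {0} e d nb with above nb
      ... | inj₁ (e′ , refl)        = inj₁ (vert e′ (trans d (sym e)))
      ... | inj₂ (top , _ , _)      = ⊥-elim (ℕ.0≢1+n (trans (sym e) (trans (cong (_% 2) top) last-row-odd)))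
      offset⇒adjacent blue  {ε = 1} {1} e d nb with above nb
      ... | inj₁ (e′ , refl)        = inj₁ (vert e′ (trans d (sym e)))
      ... | inj₂ (top , bottom , r) = inj₁ (wrap top bottom (%2≡1⇒odd d) r)
      offset⇒adjacent blue  {ε = 0} {1} e d nb with below nb
      ... | inj₁ (e′ , refl)        = inj₂ (vert e′ (trans d (sym (trans (below-parity e′) (cong (1 ∸_) e)))))
      ... | inj₂ (top , bottom , r) = inj₂ (wrap top bottom (%2≡1⇒odd (trans (Res-parity r) d)) r)
      offset⇒adjacent blue  {ε = 1} {0} e d nb with below nb
      ... | inj₁ (e′ , refl)        = inj₂ (vert e′ (trans d (sym (trans (below-parity e′) (cong (1 ∸_) e)))))
      ... | inj₂ (_ , bottom , _)   = ⊥-elim (ℕ.0≢1+n (trans (sym (cong (_% 2) bottom)) e))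
      offset⇒adjacent _ {i} {ε = suc (suc _)} e _ _ = ⊥-elim (%2≢2+ {toℕ i} e)
      offset⇒adjacent _ {j = j} {δ = suc (suc _)} _ d _ = ⊥-elim (%2≢2+ {toℕ j} d)

    adjacent⇔neighbour : ∀ u v → Adj m n k ℓ u v ⇔ (∃[ col ] Neighbour col u v)
    adjacent⇔neighbour u v = mk⇔ edge⇒neighbour± (λ (col , nb) → offset⇒adjacent col refl refl nb)
      where
      edge⇒neighbour± : Adj m n k ℓ u v → ∃[ col ] Neighbour col u v
      edge⇒neighbour± (inj₁ e) = edge⇒neighbour e
      edge⇒neighbour± (inj₂ e) = edge⇒neighbour⁻ e

  -- The classes and the rotation

  Class : Set
  Class = Fin 2 × Fin 4

  pattern c00 = zero , zero
  pattern c01 = zero , suc zero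
  pattern c02 = zero , suc (suc zero)
  pattern c03 = zero , suc (suc (suc zero))
  pattern c10 = suc zero , zero
  pattern c11 = suc zero , suc zero
  pattern c12 = suc zero , suc (suc zero)
  pattern c13 = suc zero , suc (suc (suc zero))

  Point : Set
  Point = Class × ℤ × ℤ

  coords : Point → ℤ × ℤ
  coords ((ε , δ) , a , b) = + toℕ ε + + 2 * a , + toℕ δ + + 4 * b

  neighbour-offset : ℤ → Colour → Point → ℤ × ℤ
  neighbour-offset K col ((ε , δ) , _) = offset K col (toℕ ε) (toℕ δ % 2)

  rotate-class rotate-class⁻¹ : Class → Class
  rotate-class c00 = c00
  rotate-class c01 = c03
  rotate-class c02 = c13
  rotate-class c03 = c10
  rotate-class c10 = c01
  rotate-class c11 = c02
  rotate-class c12 = c12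
  rotate-class c13 = c11
  rotate-class⁻¹ c00 = c00
  rotate-class⁻¹ c01 = c10
  rotate-class⁻¹ c02 = c11
  rotate-class⁻¹ c03 = c01
  rotate-class⁻¹ c10 = c03
  rotate-class⁻¹ c11 = c13
  rotate-class⁻¹ c12 = c12
  rotate-class⁻¹ c13 = c02

  rotate-class-inverseˡ : ∀ cl → rotate-class (rotate-class⁻¹ cl) ≡ cl
  rotate-class-inverseˡ c00 = refl
  rotate-class-inverseˡ c01 = refl
  rotate-class-inverseˡ c02 = refl
  rotate-class-inverseˡ c03 = refl
  rotate-class-inverseˡ c10 = refl
  rotate-class-inverseˡ c11 = refl
  rotate-class-inverseˡ c12 = refl
  rotate-class-inverseˡ c13 = refl

  rotate-class-inverseʳ : ∀ cl → rotate-class⁻¹ (rotate-class cl) ≡ cl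
  rotate-class-inverseʳ c00 = refl
  rotate-class-inverseʳ c01 = refl
  rotate-class-inverseʳ c02 = refl
  rotate-class-inverseʳ c03 = refl
  rotate-class-inverseʳ c10 = refl
  rotate-class-inverseʳ c11 = refl
  rotate-class-inverseʳ c12 = refl
  rotate-class-inverseʳ c13 = refl

  Poly : Set
  Poly = Expr ℤ 1

  ŵ 0̂ 1̂ -1̂ : Poly
  ŵ  = Ι zero
  0̂  = Κ 0ℤ
  1̂  = Κ 1ℤ
  -1̂ = Κ -1ℤ

  infix 9 _⟨_⟩ _⟨_⟩ᵥ _⟨_⟩ₘ
  _⟨_⟩ : Poly → ℤ → ℤ
  p ⟨ w ⟩ = eval p (w Vec.∷ Vec.[])

  _⟨_⟩ᵥ : Poly × Poly → ℤ → ℤ × ℤ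
  (p , q) ⟨ w ⟩ᵥ = p ⟨ w ⟩ , q ⟨ w ⟩

  _⟨_⟩ₘ : Matrix Poly → ℤ → Matrix ℤ
  matrix α β γ δ ⟨ w ⟩ₘ = matrix (α ⟨ w ⟩) (β ⟨ w ⟩) (γ ⟨ w ⟩) (δ ⟨ w ⟩)

  infixl 6 _⊞_
  _⊞_ : Poly × Poly → Poly × Poly → Poly × Poly
  (p , q) ⊞ (p′ , q′) = p ⊕̂ p′ , q ⊕̂ q′

  infixr 7 _⊡_
  _⊡_ : Matrix Poly → Poly × Poly → Poly × Poly
  matrix α β γ δ ⊡ (p , q) = α ⊗̂ p ⊕̂ β ⊗̂ q , γ ⊗̂ p ⊕̂ δ ⊗̂ q

  -- Equality of the normal forms computed by the ring solver, which is decided by evaluation.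
  infix 4 _≐_
  _≐_ : Poly × Poly → Poly × Poly → Set
  (p , q) ≐ (p′ , q′) = ⟦ p ⇓⟧ ≡ ⟦ p′ ⇓⟧ × ⟦ q ⇓⟧ ≡ ⟦ q′ ⇓⟧

  ≐⇒≡ : ∀ u u′ → u ≐ u′ → ∀ w → u ⟨ w ⟩ᵥ ≡ u′ ⟨ w ⟩ᵥ
  ≐⇒≡ (p , q) (p′ , q′) (p≐p′ , q≐q′) w = cong₂ _,_ (agree p p′ p≐p′) (agree q q′ q≐q′)
    where
    agree : ∀ r r′ → ⟦ r ⇓⟧ ≡ ⟦ r′ ⇓⟧ → r ⟨ w ⟩ ≡ r′ ⟨ w ⟩
    agree r r′ eq = trans (sym (correct r ρ)) (trans (cong (λ f → f ρ) eq) (correct r′ ρ))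
      where ρ = w Vec.∷ Vec.[]

  jump : Colour → Class → Class × Poly × Poly
  jump red   c00 = c01 , 0̂ , 0̂
  jump red   c01 = c00 , 0̂ , 0̂
  jump red   c02 = c03 , 0̂ , 0̂
  jump red   c03 = c02 , 0̂ , 0̂
  jump red   c10 = c11 , 0̂ , ⊝̂ (ŵ ⊕̂ 1̂)
  jump red   c11 = c10 , 0̂ , ŵ ⊕̂ 1̂
  jump red   c12 = c13 , 0̂ , ⊝̂ (ŵ ⊕̂ 1̂)
  jump red   c13 = c12 , 0̂ , ŵ ⊕̂ 1̂
  jump green c00 = c03 , 0̂ , -1̂
  jump green c01 = c02 , 0̂ , 0̂
  jump green c02 = c01 , 0̂ , 0̂
  jump green c03 = c00 , 0̂ , 1̂
  jump green c10 = c13 , 0̂ , ŵ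
  jump green c11 = c12 , 0̂ , ⊝̂ (ŵ ⊕̂ 1̂)
  jump green c12 = c11 , 0̂ , ŵ ⊕̂ 1̂
  jump green c13 = c10 , 0̂ , ⊝̂ ŵ
  jump blue  c00 = c10 , 0̂ , 0̂
  jump blue  c01 = c11 , -1̂ , 0̂
  jump blue  c02 = c12 , 0̂ , 0̂
  jump blue  c03 = c13 , -1̂ , 0̂
  jump blue  c10 = c00 , 0̂ , 0̂
  jump blue  c11 = c01 , 1̂ , 0̂
  jump blue  c12 = c02 , 0̂ , 0̂
  jump blue  c13 = c03 , 1̂ , 0̂

  ψ̂ ψ̂⁻¹ : Matrix Poly
  ψ̂   = matrix (⊝̂ (ŵ ⊕̂ 1̂)) -1̂ (⊝̂ (ŵ ⊗̂ (ŵ ⊕̂ Κ (+ 2)))) (⊝̂ (ŵ ⊕̂ 1̂))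
  ψ̂⁻¹ = matrix (⊝̂ (ŵ ⊕̂ 1̂)) 1̂ (ŵ ⊗̂ (ŵ ⊕̂ Κ (+ 2))) (⊝̂ (ŵ ⊕̂ 1̂))

  rotation-shift : Class → Poly × Poly
  rotation-shift c00 = 0̂ , 0̂
  rotation-shift c01 = 0̂ , -1̂
  rotation-shift c02 = -1̂ , -1̂
  rotation-shift c03 = -1̂ , ⊝̂ (ŵ ⊕̂ 1̂)
  rotation-shift c10 = 0̂ , 0̂
  rotation-shift c11 = ⊝̂ (ŵ ⊕̂ 1̂) , ⊝̂ ((ŵ ⊕̂ 1̂) ⊗̂ (ŵ ⊕̂ 1̂))
  rotation-shift c12 = -1̂ , ŵ
  rotation-shift c13 = ⊝̂ (ŵ ⊕̂ Κ (+ 2)) , ⊝̂ (ŵ ⊗̂ ŵ ⊕̂ Κ (+ 4) ⊗̂ ŵ ⊕̂ Κ (+ 2))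

  data Correction : Set where
    none vertical⁺ vertical⁻ diagonal⁺ diagonal⁻ : Correction

  correction-vector : Correction → Poly × Poly
  correction-vector none      = 0̂ , 0̂
  correction-vector vertical⁺ = 0̂ , Κ (+ 4) ⊗̂ ŵ ⊕̂ Κ (+ 2)
  correction-vector vertical⁻ = 0̂ , ⊝̂ (Κ (+ 4) ⊗̂ ŵ ⊕̂ Κ (+ 2))
  correction-vector diagonal⁺ = Κ (+ 2) ⊗̂ ŵ ⊕̂ 1̂ , (Κ (+ 2) ⊗̂ ŵ ⊕̂ 1̂) ⊗̂ (ŵ ⊕̂ Κ (+ 2))
  correction-vector diagonal⁻ = ⊝̂ (Κ (+ 2) ⊗̂ ŵ ⊕̂ 1̂) , ⊝̂ ((Κ (+ 2) ⊗̂ ŵ ⊕̂ 1̂) ⊗̂ (ŵ ⊕̂ Κ (+ 2)))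

  correction : Colour → Class → Correction
  correction red   c12 = vertical⁻
  correction red   c13 = vertical⁺
  correction green c10 = diagonal⁻
  correction green c11 = diagonal⁺
  correction green c12 = diagonal⁻
  correction green c13 = diagonal⁺
  correction _     _   = none

  -- On the class cl, S ∘ step col and step (rotate col) ∘ S agree up to the given correction.
  RotationCommutes : Colour → Class → Set
  RotationCommutes col cl =
    rotate-class (proj₁ (jump col cl)) ≡ proj₁ (jump (rotate col) (rotate-class cl)) ×
    ψ̂ ⊡ proj₂ (jump col cl) ⊞ rotation-shift (proj₁ (jump col cl))
      ≐ rotation-shift cl ⊞ proj₂ (jump (rotate col) (rotate-class cl)) ⊞ correction-vector (correction col cl)

  rotation-commutes : ∀ col cl → RotationCommutes col cl
  rotation-commutes red   c00 = refl , refl , refl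
  rotation-commutes red   c01 = refl , refl , refl
  rotation-commutes red   c02 = refl , refl , refl
  rotation-commutes red   c03 = refl , refl , refl
  rotation-commutes red   c10 = refl , refl , refl
  rotation-commutes red   c11 = refl , refl , refl
  rotation-commutes red   c12 = refl , refl , refl
  rotation-commutes red   c13 = refl , refl , refl
  rotation-commutes green c00 = refl , refl , refl
  rotation-commutes green c01 = refl , refl , refl
  rotation-commutes green c02 = refl , refl , refl
  rotation-commutes green c03 = refl , refl , refl
  rotation-commutes green c10 = refl , refl , refl
  rotation-commutes green c11 = refl , refl , refl
  rotation-commutes green c12 = refl , refl , refl
  rotation-commutes green c13 = refl , refl , refl
  rotation-commutes blue  c00 = refl , refl , refl
  rotation-commutes blue  c01 = refl , refl , refl
  rotation-commutes blue  c02 = refl , refl , refl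
  rotation-commutes blue  c03 = refl , refl , refl
  rotation-commutes blue  c10 = refl , refl , refl
  rotation-commutes blue  c11 = refl , refl , refl
  rotation-commutes blue  c12 = refl , refl , refl
  rotation-commutes blue  c13 = refl , refl , refl

  shift-digit : ∀ e e′ B a Δ o → e′ + B * Δ ≡ e + o → e′ + B * (a + Δ) ≡ e + B * a + o
  shift-digit e e′ B a Δ o eq = begin
    e′ + B * (a + Δ)      ≡⟨ solve (e′ ∷ B ∷ a ∷ Δ ∷ []) ⟩
    e′ + B * Δ + B * a    ≡⟨ cong (_+ B * a) eq ⟩
    e + o + B * a         ≡⟨ solve (e ∷ o ∷ B ∷ a ∷ []) ⟩
    e + B * a + o         ∎
    where open ≡-Reasoning

  minus-K : ∀ d w → d + 1ℤ + + 4 * - (w + 1ℤ) ≡ d + - (+ 4 * w + + 3)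
  minus-K = solve-∀

  plus-K : ∀ d w → d + + 4 * (w + 1ℤ) ≡ d + 1ℤ + (+ 4 * w + + 3)
  plus-K = solve-∀

  plus-K-carry : ∀ w → + 3 + + 4 * w ≡ + 0 + (+ 4 * w + + 3)
  plus-K-carry = solve-∀

  minus-K-borrow : ∀ w → + 0 + + 4 * - w ≡ + 3 + - (+ 4 * w + + 3)
  minus-K-borrow = solve-∀

  -- m₀ = 1 + 2μ, n₀ = 1 + 2ν, w = (m₀ n₀ - 1) / 2 and l = 2c - w are polynomials in μ, ν and c, so that
  -- the arithmetic relations between them hold as ring identities.
  module Cover (μ ν c : ℤ) where

    m₀ n₀ w l N L K : ℤ
    m₀ = 1ℤ + + 2 * μ
    n₀ = 1ℤ + + 2 * ν
    w  = + 2 * μ * ν + μ + ν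
    l  = + 2 * c - w
    N  = + 2 * m₀ * n₀
    L  = m₀ * l
    K  = + 4 * w + + 3

    open Lattice m₀ N L

    infix 4 _≈_
    _≈_ : Point → Point → Set
    _≈_ = Pointwise _≡_ _≋_

    ≈-isEquivalence : IsEquivalence _≈_
    ≈-isEquivalence = ×-isEquivalence isEquivalence ≋-isEquivalence

    step : Colour → Point → Point
    step col (cl , v) = proj₁ (jump col cl) , v ⊕ proj₂ (jump col cl) ⟨ w ⟩ᵥ

    step-cong : ∀ col → Congruent _≈_ _≈_ (step col)
    step-cong col {cl , _} (refl , v≋v′) = refl , ⊕-cong (proj₂ (jump col cl) ⟨ w ⟩ᵥ) v≋v′

    jump-digits : ∀ col cl → let cl′ , Δ = jump col cl ; o = offset K col (toℕ (proj₁ cl)) (toℕ (proj₂ cl) % 2) in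
                  (+ toℕ (proj₁ cl′) + + 2 * proj₁ Δ ⟨ w ⟩ ≡ + toℕ (proj₁ cl) + proj₁ o) ×
                  (+ toℕ (proj₂ cl′) + + 4 * proj₂ Δ ⟨ w ⟩ ≡ + toℕ (proj₂ cl) + proj₂ o)
    jump-digits red   c00 = refl , refl
    jump-digits red   c01 = refl , refl
    jump-digits red   c02 = refl , refl
    jump-digits red   c03 = refl , refl
    jump-digits red   c10 = refl , minus-K (+ 0) w
    jump-digits red   c11 = refl , plus-K (+ 0) w
    jump-digits red   c12 = refl , minus-K (+ 2) w
    jump-digits red   c13 = refl , plus-K (+ 2) w
    jump-digits green c00 = refl , refl
    jump-digits green c01 = refl , refl
    jump-digits green c02 = refl , refl
    jump-digits green c03 = refl , refl
    jump-digits green c10 = refl , plus-K-carry w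
    jump-digits green c11 = refl , minus-K (+ 1) w
    jump-digits green c12 = refl , plus-K (+ 1) w
    jump-digits green c13 = refl , minus-K-borrow w
    jump-digits blue  c00 = refl , refl
    jump-digits blue  c01 = refl , refl
    jump-digits blue  c02 = refl , refl
    jump-digits blue  c03 = refl , refl
    jump-digits blue  c10 = refl , refl
    jump-digits blue  c11 = refl , refl
    jump-digits blue  c12 = refl , refl
    jump-digits blue  c13 = refl , refl

    coords-step : ∀ col x → coords (step col x) ≡ coords x ⊕ neighbour-offset K col x
    coords-step col (cl@(ε , δ) , a , b) =
      cong₂ _,_ (shift-digit (+ toℕ ε) (+ toℕ (proj₁ cl′)) (+ 2) a (proj₁ Δ) (proj₁ o) (proj₁ (jump-digits col cl)))
                (shift-digit (+ toℕ δ) (+ toℕ (proj₂ cl′)) (+ 4) b (proj₂ Δ) (proj₂ o) (proj₂ (jump-digits col cl)))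
      where
      cl′ = proj₁ (jump col cl)
      Δ   = proj₂ (jump col cl) ⟨ w ⟩ᵥ
      o   = offset K col (toℕ ε) (toℕ δ % 2)

    ψ ψ⁻¹ : Matrix ℤ
    ψ   = ψ̂ ⟨ w ⟩ₘ
    ψ⁻¹ = ψ̂⁻¹ ⟨ w ⟩ₘ

    S T : Point → Point
    S (cl , v) = rotate-class cl , ψ · v ⊕ rotation-shift cl ⟨ w ⟩ᵥ
    T (cl , v) = rotate-class⁻¹ cl , ψ⁻¹ · (v ⊕ neg (rotation-shift (rotate-class⁻¹ cl) ⟨ w ⟩ᵥ))

    correction-in-lattice : ∀ κ → correction-vector κ ⟨ w ⟩ᵥ ≋ (0ℤ , 0ℤ)
    correction-in-lattice none      = ≋-at 0ℤ 0ℤ refl refl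
    correction-in-lattice vertical⁺ = ≋-at 0ℤ 1ℤ refl (vertical μ ν c)
      where
      vertical : ∀ μ ν c → let m₀ = 1ℤ + + 2 * μ ; n₀ = 1ℤ + + 2 * ν ; w = + 2 * μ * ν + μ + ν in
                 + 4 * w + + 2 ≡ 0ℤ + 1ℤ * (+ 2 * m₀ * n₀) - 0ℤ * (m₀ * (+ 2 * c - w))
      vertical = solve-∀
    correction-in-lattice vertical⁻ = neg-≋ (correction-in-lattice vertical⁺)
    correction-in-lattice diagonal⁺ = ≋-at n₀ (c + 1ℤ) (diagonal₁ μ ν) (diagonal₂ μ ν c)
      where
      diagonal₁ : ∀ μ ν → let m₀ = 1ℤ + + 2 * μ ; n₀ = 1ℤ + + 2 * ν ; w = + 2 * μ * ν + μ + ν in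
                  + 2 * w + 1ℤ ≡ 0ℤ + n₀ * m₀
      diagonal₁ = solve-∀
      diagonal₂ : ∀ μ ν c → let m₀ = 1ℤ + + 2 * μ ; n₀ = 1ℤ + + 2 * ν ; w = + 2 * μ * ν + μ + ν in
                  (+ 2 * w + 1ℤ) * (w + + 2) ≡ 0ℤ + (c + 1ℤ) * (+ 2 * m₀ * n₀) - n₀ * (m₀ * (+ 2 * c - w))
      diagonal₂ = solve-∀
    correction-in-lattice diagonal⁻ = neg-≋ (correction-in-lattice diagonal⁺)

    S-step : ∀ col x → S (step col x) ≈ step (rotate col) (S x)
    S-step col (cl , v) = proj₁ (rotation-commutes col cl) , (begin
      ψ · (v ⊕ t) ⊕ s′          ≡⟨ ·-⊕-shift ψ v t s′ ⟩
      ψ · v ⊕ (ψ · t ⊕ s′)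
        ≡⟨ cong (ψ · v ⊕_) (≐⇒≡ (ψ̂ ⊡ t̂ ⊞ ŝ′) (ŝ ⊞ t̂″ ⊞ D̂) (proj₂ (rotation-commutes col cl)) w) ⟩
      ψ · v ⊕ (s ⊕ t″ ⊕ D)
        ≈⟨ ⊕-congˡ (ψ · v) (⊕-absorb (s ⊕ t″) (correction-in-lattice (correction col cl))) ⟩
      ψ · v ⊕ (s ⊕ t″)          ≡⟨ ⊕-assoc (ψ · v) s t″ ⟨
      ψ · v ⊕ s ⊕ t″            ∎)
      where
      open SetoidReasoning ≋-setoid
      t̂ ŝ′ ŝ t̂″ D̂ : Poly × Poly
      t̂  = proj₂ (jump col cl)
      ŝ′ = rotation-shift (proj₁ (jump col cl))
      ŝ  = rotation-shift cl
      t̂″ = proj₂ (jump (rotate col) (rotate-class cl))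
      D̂  = correction-vector (correction col cl)
      t s′ s t″ D : ℤ × ℤ
      t  = t̂ ⟨ w ⟩ᵥ
      s′ = ŝ′ ⟨ w ⟩ᵥ
      s  = ŝ ⟨ w ⟩ᵥ
      t″ = t̂″ ⟨ w ⟩ᵥ
      D  = D̂ ⟨ w ⟩ᵥ

    ψ-ψ⁻¹ : ∀ u → ψ · (ψ⁻¹ · u) ≡ u
    ψ-ψ⁻¹ (a , b) = cong₂ _,_ (first w a b) (second w a b)
      where
      first : ∀ w a b → let α = - (w + 1ℤ) ; γ = w * (w + + 2) in α * (α * a + 1ℤ * b) + -1ℤ * (γ * a + α * b) ≡ a
      first = solve-∀
      second : ∀ w a b → let α = - (w + 1ℤ) ; γ = w * (w + + 2) in - γ * (α * a + 1ℤ * b) + α * (γ * a + α * b) ≡ b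
      second = solve-∀

    ψ⁻¹-ψ : ∀ u → ψ⁻¹ · (ψ · u) ≡ u
    ψ⁻¹-ψ (a , b) = cong₂ _,_ (first w a b) (second w a b)
      where
      first : ∀ w a b → let α = - (w + 1ℤ) ; γ = w * (w + + 2) in α * (α * a + -1ℤ * b) + 1ℤ * (- γ * a + α * b) ≡ a
      first = solve-∀
      second : ∀ w a b → let α = - (w + 1ℤ) ; γ = w * (w + + 2) in γ * (α * a + -1ℤ * b) + α * (- γ * a + α * b) ≡ b
      second = solve-∀

    S-T : ∀ x → S (T x) ≡ x
    S-T (cl , v) = cong₂ _,_ (rotate-class-inverseˡ cl) (begin
      ψ · (ψ⁻¹ · (v ⊕ neg s)) ⊕ s   ≡⟨ cong (_⊕ s) (ψ-ψ⁻¹ (v ⊕ neg s)) ⟩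
      v ⊕ neg s ⊕ s                 ≡⟨ ⊕-neg-cancel v s ⟩
      v                             ∎)
      where
      open ≡-Reasoning
      s = rotation-shift (rotate-class⁻¹ cl) ⟨ w ⟩ᵥ

    T-S : ∀ x → T (S x) ≡ x
    T-S (cl , v) rewrite rotate-class-inverseʳ cl = cong (cl ,_) (begin
      ψ⁻¹ · (ψ · v ⊕ s ⊕ neg s)     ≡⟨ cong (ψ⁻¹ ·_) (⊕-cancel-neg (ψ · v) s) ⟩
      ψ⁻¹ · (ψ · v)                 ≡⟨ ψ⁻¹-ψ v ⟩
      v                             ∎)
      where
      open ≡-Reasoning
      s = rotation-shift cl ⟨ w ⟩ᵥ

    origin : Point
    origin = c00 , 0ℤ , 0ℤ

    S-origin : S origin ≈ origin
    S-origin = refl , ≋-reflexive (≐⇒≡ (ψ̂ ⊡ (0̂ , 0̂) ⊞ (0̂ , 0̂)) (0̂ , 0̂) (refl , refl) w)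
      where open IsEquivalence ≋-isEquivalence using () renaming (reflexive to ≋-reflexive)

    step-distinct : ∀ col {v} → ¬ step col (c00 , v) ≈ step (rotate col) (c00 , v)
    step-distinct red   ()
    step-distinct green ()
    step-distinct blue  ()

    -- The quotient P uses the inverse (ν + 1)³ of 8 modulo n₀ and
    -- 4 (l² - w (w + 2)) = (4 l² + 3) - m₀ n₀ (m₀ n₀ + 2).
    2n₀∣ : n₀ ∣ℤ (+ 4 * l * l + + 3) → (+ 2 * n₀) ∣ℤ (l * l - w * (w + + 2))
    2n₀∣ (divides d eq) = divides P (begin
      l * l - w * (w + + 2)
        ≡⟨ key μ ν c d ⟩
      P * (+ 2 * n₀) + + 2 * cube * (+ 4 * l * l + + 3 - d * n₀)
        ≡⟨ cong (λ t → P * (+ 2 * n₀) + + 2 * cube * (t - d * n₀)) eq ⟩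
      P * (+ 2 * n₀) + + 2 * cube * (d * n₀ - d * n₀)
        ≡⟨ vanish (P * (+ 2 * n₀)) cube (d * n₀) ⟩
      P * (+ 2 * n₀)
        ∎)
      where
      open ≡-Reasoning
      cube = (ν + 1ℤ) * (ν + 1ℤ) * (ν + 1ℤ)
      P = cube * (d - m₀ * (m₀ * n₀ + + 2)) - (n₀ * n₀ + + 3 * n₀ + + 3) * (+ 2 * c * c - + 2 * c * w - w)
      key : ∀ μ ν c d →
            let m₀ = 1ℤ + + 2 * μ ; n₀ = 1ℤ + + 2 * ν ; w = + 2 * μ * ν + μ + ν ; l = + 2 * c - w
                cube = (ν + 1ℤ) * (ν + 1ℤ) * (ν + 1ℤ)
                P = cube * (d - m₀ * (m₀ * n₀ + + 2)) - (n₀ * n₀ + + 3 * n₀ + + 3) * (+ 2 * c * c - + 2 * c * w - w)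
            in l * l - w * (w + + 2) ≡ P * (+ 2 * n₀) + + 2 * cube * (+ 4 * l * l + + 3 - d * n₀)
      key = solve-∀
      vanish : ∀ x y z → x + + 2 * y * (z - z) ≡ x
      vanish = solve-∀

    ψ-cong : (+ 2 * n₀) ∣ℤ (l * l - w * (w + + 2)) → ∀ {v v′} → v ≋ v′ → ψ · v ≋ ψ · v′
    ψ-cong (divides P P-eq) =
      ·-cong ψ (≋-at (l - w - 1ℤ) P (first-generator m₀ w l) (begin
                  - (w * (w + + 2)) * m₀ + - (w + 1ℤ) * - L          ≡⟨ expand m₀ w l ⟩
                  m₀ * (l * l - w * (w + + 2)) - (l - w - 1ℤ) * L     ≡⟨ cong (λ t → m₀ * t - (l - w - 1ℤ) * L) P-eq ⟩
                  m₀ * (P * (+ 2 * n₀)) - (l - w - 1ℤ) * L            ≡⟨ collect m₀ n₀ P (l - w - 1ℤ) L ⟩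
                  0ℤ + P * N - (l - w - 1ℤ) * L                       ∎))
               (≋-at (- (+ 2 * n₀)) (- (w + 1ℤ + l)) (second-generator₁ m₀ n₀ w) (second-generator₂ m₀ n₀ w l))
      where
      open ≡-Reasoning
      first-generator : ∀ m₀ w l → - (w + 1ℤ) * m₀ + -1ℤ * - (m₀ * l) ≡ 0ℤ + (l - w - 1ℤ) * m₀
      first-generator = solve-∀
      expand : ∀ m₀ w l → - (w * (w + + 2)) * m₀ + - (w + 1ℤ) * - (m₀ * l)
                          ≡ m₀ * (l * l - w * (w + + 2)) - (l - w - 1ℤ) * (m₀ * l)
      expand = solve-∀
      collect : ∀ m₀ n₀ P x y → m₀ * (P * (+ 2 * n₀)) - x * y ≡ 0ℤ + P * (+ 2 * m₀ * n₀) - x * y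
      collect = solve-∀
      second-generator₁ : ∀ m₀ n₀ w → - (w + 1ℤ) * 0ℤ + -1ℤ * (+ 2 * m₀ * n₀) ≡ 0ℤ + - (+ 2 * n₀) * m₀
      second-generator₁ = solve-∀
      second-generator₂ : ∀ m₀ n₀ w l → - (w * (w + + 2)) * 0ℤ + - (w + 1ℤ) * (+ 2 * m₀ * n₀)
                                        ≡ 0ℤ + - (w + 1ℤ + l) * (+ 2 * m₀ * n₀) - - (+ 2 * n₀) * (m₀ * l)
      second-generator₂ = solve-∀

    ψ⁻¹-cong : (+ 2 * n₀) ∣ℤ (l * l - w * (w + + 2)) → ∀ {v v′} → v ≋ v′ → ψ⁻¹ · v ≋ ψ⁻¹ · v′
    ψ⁻¹-cong (divides P P-eq) =
      ·-cong ψ⁻¹ (≋-at (- (w + 1ℤ + l)) (- P) (first-generator m₀ w l) (begin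
                    w * (w + + 2) * m₀ + - (w + 1ℤ) * - L                   ≡⟨ expand m₀ w l ⟩
                    - (m₀ * (l * l - w * (w + + 2))) + (w + 1ℤ + l) * L     ≡⟨ cong (λ t → - (m₀ * t) + (w + 1ℤ + l) * L) P-eq ⟩
                    - (m₀ * (P * (+ 2 * n₀))) + (w + 1ℤ + l) * L            ≡⟨ collect m₀ n₀ P (w + 1ℤ + l) L ⟩
                    0ℤ + - P * N - - (w + 1ℤ + l) * L                       ∎))
                 (≋-at (+ 2 * n₀) (l - w - 1ℤ) (second-generator₁ m₀ n₀ w) (second-generator₂ m₀ n₀ w l))
      where
      open ≡-Reasoning
      first-generator : ∀ m₀ w l → - (w + 1ℤ) * m₀ + 1ℤ * - (m₀ * l) ≡ 0ℤ + - (w + 1ℤ + l) * m₀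
      first-generator = solve-∀
      expand : ∀ m₀ w l → w * (w + + 2) * m₀ + - (w + 1ℤ) * - (m₀ * l)
                          ≡ - (m₀ * (l * l - w * (w + + 2))) + (w + 1ℤ + l) * (m₀ * l)
      expand = solve-∀
      collect : ∀ m₀ n₀ P x y → - (m₀ * (P * (+ 2 * n₀))) + x * y ≡ 0ℤ + - P * (+ 2 * m₀ * n₀) - - x * y
      collect = solve-∀
      second-generator₁ : ∀ m₀ n₀ w → - (w + 1ℤ) * 0ℤ + 1ℤ * (+ 2 * m₀ * n₀) ≡ 0ℤ + + 2 * n₀ * m₀
      second-generator₁ = solve-∀
      second-generator₂ : ∀ m₀ n₀ w l → w * (w + + 2) * 0ℤ + - (w + 1ℤ) * (+ 2 * m₀ * n₀)
                                        ≡ 0ℤ + (l - w - 1ℤ) * (+ 2 * m₀ * n₀) - + 2 * n₀ * (m₀ * l)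
      second-generator₂ = solve-∀

    S-cong : (+ 2 * n₀) ∣ℤ (l * l - w * (w + + 2)) → Congruent _≈_ _≈_ S
    S-cong 2n₀∣ {cl , _} (refl , v≋v′) = refl , ⊕-cong (rotation-shift cl ⟨ w ⟩ᵥ) (ψ-cong 2n₀∣ v≋v′)

    T-cong : (+ 2 * n₀) ∣ℤ (l * l - w * (w + + 2)) → Congruent _≈_ _≈_ T
    T-cong 2n₀∣ {cl , _} (refl , v≋v′) =
      refl , ψ⁻¹-cong 2n₀∣ (⊕-cong (neg (rotation-shift (rotate-class⁻¹ cl) ⟨ w ⟩ᵥ)) v≋v′)

  -- Descent to X_a(m, n, k, ℓ)

  module Descent
    {m n k ℓ : ℕ} {P : Set} {_≈_ : P → P → Set} (≈-isEquivalence : IsEquivalence _≈_)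
    (step : Colour → P → P) (step-cong : ∀ col → Congruent _≈_ _≈_ (step col))
    (emb : Vertex m n → P) (norm : P → Vertex m n)
    (emb-norm : ∀ x → emb (norm x) ≈ x)
    (emb-injective : ∀ {u v} → emb u ≈ emb v → u ≡ v)
    (adjacent⇔step : ∀ u v → Adj m n k ℓ u v ⇔ (∃[ col ] emb v ≈ step col (emb u)))
    (S T : P → P) (S-cong : Congruent _≈_ _≈_ S) (T-cong : Congruent _≈_ _≈_ T)
    (S-T : ∀ x → S (T x) ≈ x) (T-S : ∀ x → T (S x) ≈ x)
    (S-step : ∀ col x → S (step col x) ≈ step (rotate col) (S x))
    where

    private
      setoid : Setoid _ _
      setoid = record { isEquivalence = ≈-isEquivalence }
    open Setoid setoid using () renaming (sym to ≈-sym; trans to ≈-trans)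
    open SetoidReasoning setoid

    σ τ : Vertex m n → Vertex m n
    σ u = norm (S (emb u))
    τ u = norm (T (emb u))

    σ-τ : ∀ u → σ (τ u) ≡ u
    σ-τ u = emb-injective (begin
      emb (σ (τ u))      ≈⟨ emb-norm _ ⟩
      S (emb (τ u))      ≈⟨ S-cong (emb-norm _) ⟩
      S (T (emb u))      ≈⟨ S-T _ ⟩
      emb u              ∎)

    τ-σ : ∀ u → τ (σ u) ≡ u
    τ-σ u = emb-injective (begin
      emb (τ (σ u))      ≈⟨ emb-norm _ ⟩
      T (emb (σ u))      ≈⟨ T-cong (emb-norm _) ⟩
      T (S (emb u))      ≈⟨ T-S _ ⟩
      emb u              ∎)

    T-step : ∀ col x → T (step col x) ≈ step (rotate⁻¹ col) (T x)
    T-step col x = begin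
      T (step col x)                                ≈⟨ T-cong (step-cong col (S-T x)) ⟨
      T (step col (S (T x)))                        ≡⟨ cong (λ c → T (step c (S (T x)))) (rotate-rotate⁻¹ col) ⟨
      T (step (rotate (rotate⁻¹ col)) (S (T x)))    ≈⟨ T-cong (S-step (rotate⁻¹ col) (T x)) ⟨
      T (S (step (rotate⁻¹ col) (T x)))             ≈⟨ T-S _ ⟩
      step (rotate⁻¹ col) (T x)                     ∎

    σ-adjacent : ∀ {u v} → Adj m n k ℓ u v → Adj m n k ℓ (σ u) (σ v)
    σ-adjacent {u} {v} a with col , e ← Equivalence.to (adjacent⇔step u v) a =
      Equivalence.from (adjacent⇔step (σ u) (σ v)) (rotate col , (begin
        emb (σ v)                        ≈⟨ emb-norm _ ⟩
        S (emb v)                        ≈⟨ S-cong e ⟩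
        S (step col (emb u))             ≈⟨ S-step col (emb u) ⟩
        step (rotate col) (S (emb u))    ≈⟨ step-cong _ (emb-norm _) ⟨
        step (rotate col) (emb (σ u))    ∎))

    σ-adjacent⁻ : ∀ {u v} → Adj m n k ℓ (σ u) (σ v) → Adj m n k ℓ u v
    σ-adjacent⁻ {u} {v} a with col , e ← Equivalence.to (adjacent⇔step (σ u) (σ v)) a =
      Equivalence.from (adjacent⇔step u v) (rotate⁻¹ col , (begin
        emb v                                 ≈⟨ T-S _ ⟨
        T (S (emb v))                         ≈⟨ T-cong (emb-norm _) ⟨
        T (emb (σ v))                         ≈⟨ T-cong e ⟩
        T (step col (emb (σ u)))              ≈⟨ T-step col _ ⟩
        step (rotate⁻¹ col) (T (emb (σ u)))   ≈⟨ step-cong _ (T-cong (emb-norm _)) ⟩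
        step (rotate⁻¹ col) (T (S (emb u)))   ≈⟨ step-cong _ (T-S _) ⟩
        step (rotate⁻¹ col) (emb u)           ∎))

    automorphism : Automorphism m n k ℓ
    automorphism = record
      { perm     = mk↔ₛ′ σ τ σ-τ τ-σ
      ; preserve = λ u v → mk⇔ σ-adjacent σ-adjacent⁻
      }

    module _ (u₀ : Vertex m n) (S-fixes : S (emb u₀) ≈ emb u₀)
             (distinct : ∀ col → ¬ step col (emb u₀) ≈ step (rotate col) (emb u₀)) where

      neighbour : Colour → Vertex m n
      neighbour col = norm (step col (emb u₀))

      σ-fixes : σ u₀ ≡ u₀
      σ-fixes = emb-injective (≈-trans (emb-norm _) S-fixes)

      neighbour-adjacent : ∀ col → Adj m n k ℓ u₀ (neighbour col)
      neighbour-adjacent col = Equivalence.from (adjacent⇔step u₀ _) (col , emb-norm _)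

      σ-neighbour : ∀ col → σ (neighbour col) ≡ neighbour (rotate col)
      σ-neighbour col = emb-injective (begin
        emb (σ (neighbour col))            ≈⟨ emb-norm _ ⟩
        S (emb (neighbour col))            ≈⟨ S-cong (emb-norm _) ⟩
        S (step col (emb u₀))              ≈⟨ S-step col _ ⟩
        step (rotate col) (S (emb u₀))     ≈⟨ step-cong _ S-fixes ⟩
        step (rotate col) (emb u₀)         ≈⟨ emb-norm _ ⟨
        emb (neighbour (rotate col))       ∎)

      neighbour-distinct : ∀ col → neighbour col ≢ neighbour (rotate col)
      neighbour-distinct col eq = distinct col (begin
        step col (emb u₀)                  ≈⟨ emb-norm _ ⟨
        emb (neighbour col)                ≡⟨ cong emb eq ⟩
        emb (neighbour (rotate col))       ≈⟨ emb-norm _ ⟩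
        step (rotate col) (emb u₀)         ∎)

      only-neighbours : ∀ v → Adj m n k ℓ u₀ v → v ≡ neighbour red ⊎ v ≡ neighbour green ⊎ v ≡ neighbour blue
      only-neighbours v a with col , e ← Equivalence.to (adjacent⇔step u₀ v) a with col
      ... | red   = inj₁ (emb-injective (≈-trans e (≈-sym (emb-norm _))))
      ... | green = inj₂ (inj₁ (emb-injective (≈-trans e (≈-sym (emb-norm _)))))
      ... | blue  = inj₂ (inj₂ (emb-injective (≈-trans e (≈-sym (emb-norm _)))))

      rotates-neighbours : FixesAndCyclesNeighbours automorphism u₀
      rotates-neighbours =
        σ-fixes , neighbour red , neighbour green , neighbour blue ,
        neighbour-adjacent red , neighbour-adjacent green , neighbour-adjacent blue ,
        neighbour-distinct red , neighbour-distinct green , (λ eq → neighbour-distinct blue (sym eq)) ,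
        only-neighbours , σ-neighbour red , σ-neighbour green , σ-neighbour blue

  module Presentation (μ ν c : ℤ) (m n k ℓ : ℕ) .{{_ : NonZero m}} .{{_ : NonZero n}}
    (m-even : Even m) (n-even : Even n) (ℓ-even : Even ℓ)
    (m≡ : + m ≡ + 2 * Cover.m₀ μ ν c) (n≡ : + n ≡ + 4 * Cover.N μ ν c)
    (ℓ≡ : + ℓ ≡ + 4 * Cover.L μ ν c) (k≡ : + k ≡ Cover.K μ ν c) where

    open Cover μ ν c
    open Lattice m₀ N L using (≋-by)
    private
      module G = Plane m n k ℓ m-even n-even ℓ-even
    open G using (coord; reduce; coord-reduce; coord-injective)
    open ≡-Reasoning

    private
      first-coordinate : ∀ e a q → e + + 2 * (a + q * m₀) ≡ e + + 2 * a + q * + m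
      first-coordinate e a q = begin
        e + + 2 * (a + q * m₀)          ≡⟨ distribute e a q m₀ ⟩
        e + + 2 * a + q * (+ 2 * m₀)    ≡⟨ cong (λ t → e + + 2 * a + q * t) m≡ ⟨
        e + + 2 * a + q * + m           ∎
        where
        distribute : ∀ e a q m₀ → e + + 2 * (a + q * m₀) ≡ e + + 2 * a + q * (+ 2 * m₀)
        distribute = solve-∀

      second-coordinate : ∀ e b p q → e + + 4 * (b + p * N - q * L) ≡ e + + 4 * b + p * + n - q * + ℓ
      second-coordinate e b p q = begin
        e + + 4 * (b + p * N - q * L)                  ≡⟨ distribute e b p q N L ⟩
        e + + 4 * b + p * (+ 4 * N) - q * (+ 4 * L)    ≡⟨ cong₂ (λ s t → e + + 4 * b + p * s - q * t) n≡ ℓ≡ ⟨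
        e + + 4 * b + p * + n - q * + ℓ                ∎
        where
        distribute : ∀ e b p q N L → e + + 4 * (b + p * N - q * L) ≡ e + + 4 * b + p * (+ 4 * N) - q * (+ 4 * L)
        distribute = solve-∀

    ≈⇒coords : ∀ {x y} → x ≈ y → coords x G.≋ coords y
    ≈⇒coords {(ε , δ) , _} {_ , a , b} (refl , ≋-by q p refl refl) =
      G.≋-by q p (first-coordinate (+ toℕ ε) a q) (second-coordinate (+ toℕ δ) b p q)

    coords⇒≈ : ∀ {x y} → coords x G.≋ coords y → x ≈ y
    coords⇒≈ {(ε , δ) , a , b} {(ε′ , δ′) , a′ , b′} (G.≋-by q p e₁ e₂) =
      cong₂ _,_ (toℕ-injective (proj₁ row)) (toℕ-injective (proj₁ column)) , ≋-by q p (proj₂ row) (proj₂ column)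
      where
      row : toℕ ε ≡ toℕ ε′ × a ≡ a′ + q * m₀
      row = digits-unique a (a′ + q * m₀) (toℕ<n ε) (toℕ<n ε′) (trans e₁ (sym (first-coordinate (+ toℕ ε′) a′ q)))
      column : toℕ δ ≡ toℕ δ′ × b ≡ b′ + p * N - q * L
      column = digits-unique b (b′ + p * N - q * L) (toℕ<n δ) (toℕ<n δ′)
                 (trans e₂ (sym (second-coordinate (+ toℕ δ′) b′ p q)))

    emb : Vertex m n → Point
    emb (i , j) = (toℕ i mod 2 , toℕ j mod 4) , + (toℕ i / 2) , + (toℕ j / 4)

    coords-emb : ∀ u → coords (emb u) ≡ coord u
    coords-emb (i , j) = cong₂ _,_ (digit-expansion (toℕ i) 2) (digit-expansion (toℕ j) 4)

    norm : Point → Vertex m n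
    norm x = reduce (coords x)

    emb-norm : ∀ x → emb (norm x) ≈ x
    emb-norm x = coords⇒≈ (subst (G._≋ coords x) (sym (coords-emb (norm x))) (coord-reduce (coords x)))

    emb-injective : ∀ {u v} → emb u ≈ emb v → u ≡ v
    emb-injective {u} {v} e = coord-injective (subst₂ G._≋_ (coords-emb u) (coords-emb v) (≈⇒coords e))

    emb-origin : ∀ u → IsU₀₀ u → emb u ≈ origin
    emb-origin u (i≡0 , j≡0) =
      coords⇒≈ (subst (G._≋ (0ℤ , 0ℤ)) (sym (trans (coords-emb u) (cong₂ (λ x y → + x , + y) i≡0 j≡0)))
                      (IsEquivalence.refl G.≋-isEquivalence))

    coords-step-emb : ∀ col i j → coords (step col (emb (i , j))) ≡ coord (i , j) ⊕ offset (+ k) col (toℕ i % 2) (toℕ j % 2)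
    coords-step-emb col i j = begin
      coords (step col (emb (i , j)))                                             ≡⟨ coords-step col (emb (i , j)) ⟩
      coords (emb (i , j)) ⊕ neighbour-offset K col (emb (i , j))                 ≡⟨ cong₂ _⊕_ (coords-emb (i , j)) offset≡ ⟩
      coord (i , j) ⊕ offset (+ k) col (toℕ i % 2) (toℕ j % 2)                    ∎
      where
      row-parity : toℕ (toℕ i mod 2) ≡ toℕ i % 2
      row-parity = toℕ-fromℕ< (m%n<n (toℕ i) 2)
      column-parity : toℕ (toℕ j mod 4) % 2 ≡ toℕ j % 2
      column-parity = trans (cong (_% 2) (toℕ-fromℕ< (m%n<n (toℕ j) 4))) (m∣n⇒o%n%m≡o%m 2 4 (toℕ j) (divides 2 refl))
      offset≡ : neighbour-offset K col (emb (i , j)) ≡ offset (+ k) col (toℕ i % 2) (toℕ j % 2)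
      offset≡ = cong₂ (λ K (εδ : ℕ × ℕ) → offset K col (proj₁ εδ) (proj₂ εδ))
                      (sym k≡) (cong₂ _,_ row-parity column-parity)

    adjacent⇔step : ∀ u v → Adj m n k ℓ u v ⇔ (∃[ col ] emb v ≈ step col (emb u))
    adjacent⇔step u@(i , j) v = mk⇔
      (λ a → let col , nb = Equivalence.to (G.adjacent⇔neighbour u v) a in
             col , coords⇒≈ (subst₂ G._≋_ (sym (coords-emb v)) (sym (coords-step-emb col i j)) nb))
      (λ (col , e) → Equivalence.from (G.adjacent⇔neighbour u v)
                       (col , subst₂ G._≋_ (coords-emb v) (coords-step-emb col i j) (≈⇒coords e)))

  module Construction (μ ν l c d : ℕ)
    (hc : suc (μ ℕ.* 2) ℕ.* suc (ν ℕ.* 2) ℕ.+ l ℕ.* 2 ∸ 1 ≡ c ℕ.* 4)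
    (hd : (l ℕ.* 2) ^ 2 ℕ.+ 3 ≡ d ℕ.* suc (ν ℕ.* 2)) where

    m₀ n₀ ℓ₀ : ℕ
    m₀ = suc (μ ℕ.* 2)
    n₀ = suc (ν ℕ.* 2)
    ℓ₀ = l ℕ.* 2

    module C = Cover (+ μ) (+ ν) (+ c)
    open ≡-Reasoning

    l-cast : + l ≡ C.l
    l-cast = solve-for-l (+ μ) (+ ν) (+ l) (+ c) hc-cast
      where
      solve-for-l : ∀ x y t z → + 2 * y + + 2 * x * (1ℤ + + 2 * y) + + 2 * t ≡ + 4 * z → t ≡ + 2 * z - (+ 2 * x * y + x + y)
      solve-for-l x y t z eq = *-cancelˡ-≡ (+ 2) t _ (begin
        + 2 * t                                                          ≡⟨ solve (x ∷ y ∷ t ∷ []) ⟩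
        + 2 * y + + 2 * x * (1ℤ + + 2 * y) + + 2 * t - (+ 2 * y + + 2 * x * (1ℤ + + 2 * y))
                                                                         ≡⟨ cong (_- (+ 2 * y + + 2 * x * (1ℤ + + 2 * y))) eq ⟩
        + 4 * z - (+ 2 * y + + 2 * x * (1ℤ + + 2 * y))                   ≡⟨ solve (x ∷ y ∷ z ∷ []) ⟩
        + 2 * (+ 2 * z - (+ 2 * x * y + x + y))                          ∎)
      hc-cast : + 2 * + ν + + 2 * + μ * (1ℤ + + 2 * + ν) + + 2 * + l ≡ + 4 * + c
      hc-cast = begin
        + 2 * + ν + + 2 * + μ * (1ℤ + + 2 * + ν) + + 2 * + l
          ≡⟨ cong₂ _+_ (cong₂ _+_ (pos-double ν) (cong₂ _*_ (pos-double μ) (pos-odd ν))) (pos-double l) ⟨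
        + (ν ℕ.* 2) + + (μ ℕ.* 2) * + n₀ + + (l ℕ.* 2)
          ≡⟨ cong (_+ + (l ℕ.* 2))
                  (trans (cong (λ t → + (ν ℕ.* 2) + t) (sym (pos-* (μ ℕ.* 2) n₀))) (sym (pos-+ (ν ℕ.* 2) _))) ⟩
        + (ν ℕ.* 2 ℕ.+ μ ℕ.* 2 ℕ.* n₀) + + (l ℕ.* 2)
          ≡⟨ pos-+ _ (l ℕ.* 2) ⟨
        + (ν ℕ.* 2 ℕ.+ μ ℕ.* 2 ℕ.* n₀ ℕ.+ l ℕ.* 2)
          ≡⟨ cong +_ hc ⟩
        + (c ℕ.* 4)
          ≡⟨ trans (pos-* c 4) (ℤ.*-comm (+ c) (+ 4)) ⟩
        + 4 * + c ∎

    m-cast : + (2 ℕ.* m₀) ≡ + 2 * C.m₀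
    m-cast = trans (pos-* 2 m₀) (cong (λ t → + 2 * t) (pos-odd μ))

    n-cast : + (8 ℕ.* m₀ ℕ.* n₀) ≡ + 4 * C.N
    n-cast = begin
      + (8 ℕ.* m₀ ℕ.* n₀)        ≡⟨ trans (pos-* (8 ℕ.* m₀) n₀) (cong (_* + n₀) (pos-* 8 m₀)) ⟩
      + 8 * + m₀ * + n₀           ≡⟨ cong₂ (λ x y → + 8 * x * y) (pos-odd μ) (pos-odd ν) ⟩
      + 8 * C.m₀ * C.n₀           ≡⟨ eight C.m₀ C.n₀ ⟩
      + 4 * C.N                   ∎
      where
      eight : ∀ x y → + 8 * x * y ≡ + 4 * (+ 2 * x * y)
      eight = solve-∀

    ℓ-cast : + (2 ℕ.* m₀ ℕ.* ℓ₀) ≡ + 4 * C.L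
    ℓ-cast = begin
      + (2 ℕ.* m₀ ℕ.* ℓ₀)          ≡⟨ trans (pos-* (2 ℕ.* m₀) ℓ₀) (cong₂ _*_ (pos-* 2 m₀) (pos-double l)) ⟩
      + 2 * + m₀ * (+ 2 * + l)      ≡⟨ cong₂ (λ x y → + 2 * x * (+ 2 * y)) (pos-odd μ) l-cast ⟩
      + 2 * C.m₀ * (+ 2 * C.l)      ≡⟨ four C.m₀ C.l ⟩
      + 4 * C.L                     ∎
      where
      four : ∀ x y → + 2 * x * (+ 2 * y) ≡ + 4 * (x * y)
      four = solve-∀

    k-cast : + (2 ℕ.* m₀ ℕ.* n₀ ℕ.+ 1) ≡ + 4 * C.w + + 3
    k-cast = begin
      + (2 ℕ.* m₀ ℕ.* n₀ ℕ.+ 1)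
        ≡⟨ trans (pos-+ (2 ℕ.* m₀ ℕ.* n₀) 1) (cong (_+ 1ℤ) (trans (pos-* (2 ℕ.* m₀) n₀) (cong (_* + n₀) (pos-* 2 m₀)))) ⟩
      + 2 * + m₀ * + n₀ + 1ℤ        ≡⟨ cong₂ (λ x y → + 2 * x * y + 1ℤ) (pos-odd μ) (pos-odd ν) ⟩
      + 2 * C.m₀ * C.n₀ + 1ℤ        ≡⟨ product (+ μ) (+ ν) ⟩
      + 4 * C.w + + 3               ∎
      where
      product : ∀ x y → + 2 * (1ℤ + + 2 * x) * (1ℤ + + 2 * y) + 1ℤ ≡ + 4 * (+ 2 * x * y + x + y) + + 3
      product = solve-∀

    n₀∣ : C.n₀ ∣ℤ (+ 4 * C.l * C.l + + 3)
    n₀∣ = divides (+ d) (begin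
      + 4 * C.l * C.l + + 3                          ≡⟨ cong (λ t → + 4 * t * t + + 3) l-cast ⟨
      + 4 * + l * + l + + 3                          ≡⟨ square (+ l) ⟩
      + 2 * + l * (+ 2 * + l * + 1) + + 3            ≡⟨ cong₂ (λ x y → x * (x * + 1) + y) (pos-double l) refl ⟨
      + ℓ₀ * (+ ℓ₀ * + 1) + + 3
        ≡⟨ cong (_+ + 3) (trans (cong (+ ℓ₀ *_) (sym (pos-* ℓ₀ 1))) (sym (pos-* ℓ₀ _))) ⟩
      + (ℓ₀ ^ 2) + + 3                               ≡⟨ trans (sym (pos-+ (ℓ₀ ^ 2) 3)) (cong +_ hd) ⟩
      + (d ℕ.* n₀)                                   ≡⟨ trans (pos-* d n₀) (cong (+ d *_) (pos-odd ν)) ⟩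
      + d * C.n₀                                     ∎)
      where
      square : ∀ x → + 4 * x * x + + 3 ≡ + 2 * x * (+ 2 * x * + 1) + + 3
      square = solve-∀

    module P = Presentation (+ μ) (+ ν) (+ c) (2 ℕ.* m₀) (8 ℕ.* m₀ ℕ.* n₀) (2 ℕ.* m₀ ℕ.* n₀ ℕ.+ 1) (2 ℕ.* m₀ ℕ.* ℓ₀)
                           (∣m⇒∣m*n m₀ (divides 1 refl)) (∣m⇒∣m*n n₀ (∣m⇒∣m*n m₀ (divides 4 refl)))
                           (∣m⇒∣m*n ℓ₀ (∣m⇒∣m*n m₀ (divides 1 refl))) m-cast n-cast ℓ-cast k-cast

    open IsEquivalence C.≈-isEquivalence using () renaming (reflexive to ≈-reflexive; sym to ≈-sym; trans to ≈-trans)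

    module D = Descent C.≈-isEquivalence C.step C.step-cong P.emb P.norm P.emb-norm P.emb-injective P.adjacent⇔step
                       C.S C.T (C.S-cong (C.2n₀∣ n₀∣)) (C.T-cong (C.2n₀∣ n₀∣))
                       (λ x → ≈-reflexive (C.S-T x)) (λ x → ≈-reflexive (C.T-S x)) C.S-step

    rotation : (u₀₀ : Vertex (2 ℕ.* m₀) (8 ℕ.* m₀ ℕ.* n₀)) → IsU₀₀ u₀₀ →
               ∃[ σ ] FixesAndCyclesNeighbours {2 ℕ.* m₀} {8 ℕ.* m₀ ℕ.* n₀} {2 ℕ.* m₀ ℕ.* n₀ ℕ.+ 1} {2 ℕ.* m₀ ℕ.* ℓ₀} σ u₀₀
    rotation u₀₀ u₀₀-origin = D.automorphism , D.rotates-neighbours u₀₀ S-fixes distinct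
      where
      at-origin = P.emb-origin u₀₀ u₀₀-origin
      S-fixes : C.S (P.emb u₀₀) C.≈ P.emb u₀₀
      S-fixes = ≈-trans (C.S-cong (C.2n₀∣ n₀∣) at-origin) (≈-trans C.S-origin (≈-sym at-origin))
      distinct : ∀ col → ¬ C.step col (P.emb u₀₀) C.≈ C.step (rotate col) (P.emb u₀₀)
      distinct col e = C.step-distinct col {0ℤ , 0ℤ}
        (≈-trans (≈-sym (C.step-cong col at-origin)) (≈-trans e (C.step-cong (rotate col) at-origin)))

  rotation : ∀ {m₀ n₀ ℓ₀} μ ν l c d → m₀ ≡ suc (μ ℕ.* 2) → n₀ ≡ suc (ν ℕ.* 2) → ℓ₀ ≡ l ℕ.* 2 →
             m₀ ℕ.* n₀ ℕ.+ ℓ₀ ∸ 1 ≡ c ℕ.* 4 → ℓ₀ ^ 2 ℕ.+ 3 ≡ d ℕ.* n₀ →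
             (u₀₀ : Vertex (2 ℕ.* m₀) (8 ℕ.* m₀ ℕ.* n₀)) → IsU₀₀ u₀₀ →
             ∃[ σ ] FixesAndCyclesNeighbours {2 ℕ.* m₀} {8 ℕ.* m₀ ℕ.* n₀} {2 ℕ.* m₀ ℕ.* n₀ ℕ.+ 1} {2 ℕ.* m₀ ℕ.* ℓ₀} σ u₀₀
  rotation μ ν l c d refl refl refl hc hd = Construction.rotation μ ν l c d hc hd

open import Data.Nat using (ℕ; _+_; _*_; _∸_; _^_; _<_; _≥_)
open import Data.Nat.Divisibility using (_∣_; divides)
open import Data.Nat.DivMod using (_/_)
open import Data.Product using (∃-syntax)
open Rotation using (rotation; odd⇒suc-double)

proposition7p12 : (m₀ n₀ ℓ₀ : ℕ) → Odd m₀ → Odd n₀ → m₀ ≥ 3 →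
    Even ℓ₀ → ℓ₀ < 4 * n₀ → 4 ∣ (m₀ * n₀ + ℓ₀ ∸ 1) → n₀ ∣ (ℓ₀ ^ 2 + 3) →
    (u₀₀ : Vertex (2 * m₀) (8 * m₀ * n₀)) → IsU₀₀ u₀₀ →
    ∃[ σ ] FixesAndCyclesNeighbours {2 * m₀} {8 * m₀ * n₀} {2 * m₀ * n₀ + 1} {2 * m₀ * ℓ₀} σ u₀₀
proposition7p12 m₀ n₀ ℓ₀ m₀-odd n₀-odd _ (divides l ℓ₀≡) _ (divides c hc) (divides d hd) =
  rotation (m₀ / 2) (n₀ / 2) l c d (odd⇒suc-double m₀-odd) (odd⇒suc-double n₀-odd) ℓ₀≡ hc hd
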